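{- Let $\mathbf{L}$ be one of the logics described in the context. (1) Identity is an equivalence relation in $\mathbf{G3Q\lambda.L}$: for every label $w$ and variables $x,y,z$, the sequents $\Rightarrow w:x=x$, $w:x=y\Rightarrow w:y=x$ and $w:x=y,w:y=z\Rightarrow w:x=z$ are derivable. (2) The following sequents are $\mathbf{G3Q\lambda.L}$-derivable (for every label $w$, variables $x,y,z,x_1$, term $t$ and $\mathcal{L}^\lambda$-formula $A$, with the substitutions well defined): (a) $\Rightarrow w:x=x$; (b) $w:z=y,\,w:A[z/x]\Rightarrow w:A[y/x]$; (c) $w:z=y,\,D(t,x_1,w)[z/x]\Rightarrow D(t,x_1,w)[y/x]$. (3) The following rules are admissible in $\mathbf{G3Q\lambda.L}$: $Repl_1$: from $w:A[y/x],w:z=y,w:A[z/x],\Gamma\Rightarrow\Delta$ infer $w:z=y,w:A[z/x],\Gamma\Rightarrow\Delta$; $Repl_2$: from $D(t,x_1,w)[y/x],w:z=y,D(t,x_1,w)[z/x],\Gamma\Rightarrow\Delta$ infer $w:z=y,D(t,x_1,w)[z/x],\Gamma\Rightarrow\Delta$.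
   Context: Language $\mathcal{L}^\lambda$: fix a signature of $n$-ary predicate letters and an infinite set of variables $x,y,z,\dots$. Terms and formulas are defined simultaneously: terms $t::=x\mid \iota xA$ (definite descriptions), formulas $A::=Px_1\dots x_n\mid x_1=x_2\mid\bot\mid A\wedge A\mid A\vee A\mid A\supset A\mid\forall xA\mid\exists xA\mid\Box A\mid\Diamond A\mid \lambda xA.t$. $\iota x$ binds $x$ in $A$; in $\lambda xA.t$ the occurrences of $x$ in $A$ are bound by $\lambda x$ (the displayed $t$ is not in its scope). $A[y/x]$ replaces free occurrences of $x$ by $y$, with $y$ free for $x$. Atomic formulas are $Px_1\dots x_n$ and $x_1=x_2$. Labelled sequents. Labels $w,v,u,\dots$ form a separate set. Expressions: labelled formulas $w:A$, domain atoms $x\in w$, relational atoms $w\mathscr{R}v$, denotation formulas $D(t,x,w)$ ($t$ a term, $x$ a variable). A sequent $\Gamma\Rightarrow\Delta$ has $\Gamma$ a multiset of labelled formulas, denotation formulas, domain atoms and relational atoms, and $\Delta$ a multiset of labelled formulas and denotation formulas. Substitutions $[y/x]$, $[w/v]$ extend componentwise. "Fresh" means not occurring in the conclusion of the rule. Calculus $\mathbf{G3Q\lambda.K}$. Initial sequents: $w:p,\Gamma\Rightarrow\Delta,w:p$ ($p$ atomic); $D(y,x,w),\Gamma\Rightarrow\Delta,D(y,x,w)$ ($y$ a variable); $w:\bot,\Gamma\Rightarrow\Delta$. Propositional rules (at one label $w$): $L\wedge$: from $w:A,w:B,\Gamma\Rightarrow\Delta$ infer $w:A\wedge B,\Gamma\Rightarrow\Delta$;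 $R\wedge$: from $\Gamma\Rightarrow\Delta,w:A$ and $\Gamma\Rightarrow\Delta,w:B$ infer $\Gamma\Rightarrow\Delta,w:A\wedge B$; $L\vee$: from $w:A,\Gamma\Rightarrow\Delta$ and $w:B,\Gamma\Rightarrow\Delta$ infer $w:A\vee B,\Gamma\Rightarrow\Delta$; $R\vee$: from $\Gamma\Rightarrow\Delta,w:A,w:B$ infer $\Gamma\Rightarrow\Delta,w:A\vee B$; $L\supset$: from $\Gamma\Rightarrow\Delta,w:A$ and $w:B,\Gamma\Rightarrow\Delta$ infer $w:A\supset B,\Gamma\Rightarrow\Delta$; $R\supset$: from $w:A,\Gamma\Rightarrow\Delta,w:B$ infer $\Gamma\Rightarrow\Delta,w:A\supset B$. Quantifiers: $L\forall$: from $w:A[y/x],y\in w,w:\forall xA,\Gamma\Rightarrow\Delta$ infer $y\in w,w:\forall xA,\Gamma\Rightarrow\Delta$; $R\forall$ ($z$ fresh): from $z\in w,\Gamma\Rightarrow\Delta,w:A[z/x]$ infer $\Gamma\Rightarrow\Delta,w:\forall xA$; $L\exists$ ($z$ fresh): from $z\in w,w:A[z/x],\Gamma\Rightarrow\Delta$ infer $w:\exists xA,\Gamma\Rightarrow\Delta$; $R\exists$: from $y\in w,\Gamma\Rightarrow\Delta,w:\exists xA,w:A[y/x]$ infer $y\in w,\Gamma\Rightarrow\Delta,w:\exists xA$. Modalities: $L\Box$: from $v:A,w\mathscr{R}v,w:\Box A,\Gamma\Rightarrow\Delta$ infer $w\mathscr{R}v,w:\Box A,\Gamma\Rightarrow\Delta$;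 $R\Box$ ($u$ fresh): from $w\mathscr{R}u,\Gamma\Rightarrow\Delta,u:A$ infer $\Gamma\Rightarrow\Delta,w:\Box A$; $L\Diamond$ ($u$ fresh): from $w\mathscr{R}u,u:A,\Gamma\Rightarrow\Delta$ infer $w:\Diamond A,\Gamma\Rightarrow\Delta$; $R\Diamond$: from $w\mathscr{R}v,\Gamma\Rightarrow\Delta,w:\Diamond A,v:A$ infer $w\mathscr{R}v,\Gamma\Rightarrow\Delta,w:\Diamond A$. Identity: $Ref_=$: from $w:x=x,\Gamma\Rightarrow\Delta$ infer $\Gamma\Rightarrow\Delta$; $RigVar$: from $v:y=z,w:y=z,\Gamma\Rightarrow\Delta$ infer $w:y=z,\Gamma\Rightarrow\Delta$; $Repl$: from $E[z/x],E[y/x],w:y=z,\Gamma\Rightarrow\Delta$ infer $E[y/x],w:y=z,\Gamma\Rightarrow\Delta$, where $E$ is a denotation formula with variable first argument and label $w$, a domain atom $x'\in w$, or a labelled atomic formula $w:p$. $\lambda$: $L\lambda$ ($z$ fresh): from $D(t,z,w),w:B[z/x],\Gamma\Rightarrow\Delta$ infer $w:\lambda xB.t,\Gamma\Rightarrow\Delta$; $R\lambda$: from $\Gamma\Rightarrow\Delta,w:\lambda xB.t,D(t,y,w)$ and $\Gamma\Rightarrow\Delta,w:\lambda xB.t,w:B[y/x]$ infer $\Gamma\Rightarrow\Delta,w:\lambda xB.t$. Denotation: $LD_1$: from $w:A[x_2/x_1],D(\iota x_1A,x_2,w),\Gamma\Rightarrow\Delta$ infer $D(\iota x_1A,x_2,w),\Gamma\Rightarrow\Delta$;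 $LD_2$: from $D(\iota x_1A,x_2,w),\Gamma\Rightarrow\Delta,w:A[y/x_1]$ and $w:x_2=y,D(\iota x_1A,x_2,w),\Gamma\Rightarrow\Delta$ infer $D(\iota x_1A,x_2,w),\Gamma\Rightarrow\Delta$; $RD$ ($z$ fresh): from $\Gamma\Rightarrow\Delta,w:A[x_2/x_1]$ and $w:A[z/x_1],\Gamma\Rightarrow\Delta,w:x_2=z$ infer $\Gamma\Rightarrow\Delta,D(\iota x_1A,x_2,w)$; $DenVar$: from $D(x,x,w),\Gamma\Rightarrow\Delta$ infer $\Gamma\Rightarrow\Delta$; $DenId$: from $w:y=x,D(y,x,w),\Gamma\Rightarrow\Delta$ infer $D(y,x,w),\Gamma\Rightarrow\Delta$ ($x,y$ variables). Non-logical rules: $Ref_\mathcal{W}$: from $w\mathscr{R}w,\Gamma\Rightarrow\Delta$ infer $\Gamma\Rightarrow\Delta$; $Ser$ ($u$ fresh): from $w\mathscr{R}u,\Gamma\Rightarrow\Delta$ infer $\Gamma\Rightarrow\Delta$; $Trans$: from $w\mathscr{R}u,w\mathscr{R}v,v\mathscr{R}u,\Gamma\Rightarrow\Delta$ infer $w\mathscr{R}v,v\mathscr{R}u,\Gamma\Rightarrow\Delta$; $Eucl$: from $v\mathscr{R}u,w\mathscr{R}v,w\mathscr{R}u,\Gamma\Rightarrow\Delta$ infer $w\mathscr{R}v,w\mathscr{R}u,\Gamma\Rightarrow\Delta$, always together with $Eucl^c$: from $v\mathscr{R}v,w\mathscr{R}v,\Gamma\Rightarrow\Delta$ infer $w\mathscr{R}v,\Gamma\Rightarrow\Delta$;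 $Incr$: from $x\in v,x\in w,w\mathscr{R}v,\Gamma\Rightarrow\Delta$ infer $x\in w,w\mathscr{R}v,\Gamma\Rightarrow\Delta$; $Decr$: from $x\in w,x\in v,w\mathscr{R}v,\Gamma\Rightarrow\Delta$ infer $x\in v,w\mathscr{R}v,\Gamma\Rightarrow\Delta$; $Cons$: from $x\in w,\Gamma\Rightarrow\Delta$ infer $\Gamma\Rightarrow\Delta$. For any set $N$ of these non-logical rules, $\mathbf{G3Q\lambda.L}=\mathbf{G3Q\lambda.K}+N$. Derivations: trees of (pure: no variable both free and bound) sequents with initial sequents at the leaves, built by the rules; $\Gamma\Rightarrow\Delta$ is derivable if it or an alphabetic variant has a derivation. A rule is admissible if derivability of its premisses implies derivability of its conclusion. -}

module Defs where

open import Data.Nat using (ℕ; zero; suc; _≡ᵇ_)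
open import Data.Fin using (Fin; zero; suc)
open import Data.Bool using (if_then_else_)
open import Data.List using (List; []; _∷_; _++_; map)
open import Data.List.Membership.Propositional using (_∈_; _∉_)
open import Data.List.Relation.Binary.Permutation.Propositional using (_↭_)

-- Syntax of L^λ in locally nameless style (well-scoped):
-- free variables are names (ℕ), bound variables are de Bruijn indices
-- (Fin n).  Alphabetic variants are therefore syntactically identical,
-- and "pure" (no variable both free and bound) holds automatically.

Var : Set
Var = ℕ

Label : Set
Label = ℕ

PredSym : Set
PredSym = ℕ

data V (n : ℕ) : Set where
  fv : Var → V n
  bv : Fin n → V n

mutual
  data Term (n : ℕ) : Set where
    var  : V n → Term n
    iota : Form (suc n) → Term n            -- ι x A  (x is index 0 in A)

  data Form (n : ℕ) : Set where
    Pr   : PredSym → List (V n) → Form n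
    Eq   : V n → V n → Form n
    Bot  : Form n
    And  : Form n → Form n → Form n
    Or   : Form n → Form n → Form n
    Imp  : Form n → Form n → Form n
    All  : Form (suc n) → Form n
    Ex   : Form (suc n) → Form n
    Box  : Form n → Form n
    Dia  : Form n → Form n
    Lam  : Form (suc n) → Term n → Form n    -- λ x A . t  (t not in scope of x)

data IsAtomic {n : ℕ} : Form n → Set where
  at-pred : ∀ P xs → IsAtomic (Pr P xs)
  at-eq   : ∀ x y → IsAtomic (Eq x y)

wkV : ∀ {n} → V n → V (suc n)
wkV (fv x) = fv x
wkV (bv i) = bv (suc i)

liftR : ∀ {m n} → (V m → V n) → V (suc m) → V (suc n)
liftR ρ (bv zero)    = bv zero
liftR ρ (bv (suc i)) = wkV (ρ (bv i))
liftR ρ (fv x)       = wkV (ρ (fv x))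

mutual
  renT : ∀ {m n} → (V m → V n) → Term m → Term n
  renT ρ (var v)  = var (ρ v)
  renT ρ (iota A) = iota (renF (liftR ρ) A)

  renF : ∀ {m n} → (V m → V n) → Form m → Form n
  renF ρ (Pr P xs)  = Pr P (map ρ xs)
  renF ρ (Eq x y)   = Eq (ρ x) (ρ y)
  renF ρ Bot        = Bot
  renF ρ (And A B)  = And (renF ρ A) (renF ρ B)
  renF ρ (Or A B)   = Or (renF ρ A) (renF ρ B)
  renF ρ (Imp A B)  = Imp (renF ρ A) (renF ρ B)
  renF ρ (All A)    = All (renF (liftR ρ) A)
  renF ρ (Ex A)     = Ex (renF (liftR ρ) A)
  renF ρ (Box A)    = Box (renF ρ A)
  renF ρ (Dia A)    = Dia (renF ρ A)
  renF ρ (Lam A t)  = Lam (renF (liftR ρ) A) (renT ρ t)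

instV : ∀ {n} → V n → V (suc n) → V n
instV y (bv zero)    = y
instV y (bv (suc i)) = bv i
instV y (fv x)       = fv x

-- A[y/x] where x is the variable bound by the binder whose body is A
inst : Form 1 → Var → Form 0
inst A y = renF (instV (fv y)) A

svar : Var → Var → Var → Var
svar y x z = if z ≡ᵇ x then y else z

fsubV : ∀ {n} → Var → Var → V n → V n
fsubV y x (fv z) = fv (svar y x z)
fsubV y x (bv i) = bv i

subF : Var → Var → Form 0 → Form 0
subF y x = renF (fsubV y x)

subT : Var → Var → Term 0 → Term 0
subT y x = renT (fsubV y x)

eqv : Var → Var → Form 0
eqv x y = Eq (fv x) (fv y)

-- expressions allowed in the succedent
data Fm : Set where
  _∶_ : Label → Form 0 → Fm
  D   : Term 0 → Var → Label → Fm

-- expressions allowed in the antecedent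
data LItem : Set where
  F   : Fm → LItem
  dom : Var → Label → LItem
  rel : Label → Label → LItem

subFm : Var → Var → Fm → Fm
subFm y x (w ∶ A)   = w ∶ subF y x A
subFm y x (D t z w) = D (subT y x t) (svar y x z) w

subL : Var → Var → LItem → LItem
subL y x (F f)       = F (subFm y x f)
subL y x (dom z w)   = dom (svar y x z) w
subL y x (rel w v)   = rel w v

varsV : ∀ {n} → V n → List Var
varsV (fv x) = x ∷ []
varsV (bv i) = []

varsVs : ∀ {n} → List (V n) → List Var
varsVs []       = []
varsVs (v ∷ vs) = varsV v ++ varsVs vs

mutual
  varsT : ∀ {n} → Term n → List Var
  varsT (var v)  = varsV v
  varsT (iota A) = varsF A

  varsF : ∀ {n} → Form n → List Var
  varsF (Pr P xs) = varsVs xs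
  varsF (Eq x y)  = varsV x ++ varsV y
  varsF Bot       = []
  varsF (And A B) = varsF A ++ varsF B
  varsF (Or A B)  = varsF A ++ varsF B
  varsF (Imp A B) = varsF A ++ varsF B
  varsF (All A)   = varsF A
  varsF (Ex A)    = varsF A
  varsF (Box A)   = varsF A
  varsF (Dia A)   = varsF A
  varsF (Lam A t) = varsF A ++ varsT t

varsFm : Fm → List Var
varsFm (w ∶ A)   = varsF A
varsFm (D t x w) = varsT t ++ (x ∷ [])

varsL : LItem → List Var
varsL (F f)     = varsFm f
varsL (dom x w) = x ∷ []
varsL (rel w v) = []

labsFm : Fm → List Label
labsFm (w ∶ A)   = w ∷ []
labsFm (D t x w) = w ∷ []

labsL : LItem → List Label
labsL (F f)     = labsFm f
labsL (dom x w) = w ∷ []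
labsL (rel w v) = w ∷ v ∷ []

concatMapL : {A B : Set} → (A → List B) → List A → List B
concatMapL f []       = []
concatMapL f (a ∷ as) = f a ++ concatMapL f as

varsSeq : List LItem → List Fm → List Var
varsSeq Γ Δ = concatMapL varsL Γ ++ concatMapL varsFm Δ

labsSeq : List LItem → List Fm → List Label
labsSeq Γ Δ = concatMapL labsL Γ ++ concatMapL labsFm Δ

FreshVar : Var → List LItem → List Fm → Set
FreshVar z Γ Δ = z ∉ varsSeq Γ Δ

FreshLab : Label → List LItem → List Fm → Set
FreshLab u Γ Δ = u ∉ labsSeq Γ Δ

-- Non-logical rules; a logic L is given by a set N of them

data NRule : Set where
  RefW Ser Trans Eucl Incr Decr Cons : NRule

data ReplItem (w : Label) : LItem → Set where
  r-den  : ∀ v x → ReplItem w (F (D (var v) x w))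
  r-dom  : ∀ x → ReplItem w (dom x w)
  r-atom : ∀ {p} → IsAtomic p → ReplItem w (F (w ∶ p))

-- Derivability in G3Qλ.K + N.  Antecedent/succedent are multisets,
-- modelled as lists identified up to permutation (constructor `exch`).

infix 3 _⊢_⇒_

data _⊢_⇒_ (N : List NRule) : List LItem → List Fm → Set where
  exch : ∀ {Γ Γ' Δ Δ'} → Γ ↭ Γ' → Δ ↭ Δ' → N ⊢ Γ ⇒ Δ → N ⊢ Γ' ⇒ Δ'
  initAt : ∀ {w p Γ Δ} → IsAtomic p → N ⊢ F (w ∶ p) ∷ Γ ⇒ (w ∶ p) ∷ Δ
  initD  : ∀ {y x w Γ Δ} → N ⊢ F (D (var (fv y)) x w) ∷ Γ ⇒ D (var (fv y)) x w ∷ Δ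
  initBot : ∀ {w Γ Δ} → N ⊢ F (w ∶ Bot) ∷ Γ ⇒ Δ
  L∧ : ∀ {w A B Γ Δ} → N ⊢ F (w ∶ A) ∷ F (w ∶ B) ∷ Γ ⇒ Δ → N ⊢ F (w ∶ And A B) ∷ Γ ⇒ Δ
  R∧ : ∀ {w A B Γ Δ} → N ⊢ Γ ⇒ (w ∶ A) ∷ Δ → N ⊢ Γ ⇒ (w ∶ B) ∷ Δ → N ⊢ Γ ⇒ (w ∶ And A B) ∷ Δ
  L∨ : ∀ {w A B Γ Δ} → N ⊢ F (w ∶ A) ∷ Γ ⇒ Δ → N ⊢ F (w ∶ B) ∷ Γ ⇒ Δ → N ⊢ F (w ∶ Or A B) ∷ Γ ⇒ Δ
  R∨ : ∀ {w A B Γ Δ} → N ⊢ Γ ⇒ (w ∶ A) ∷ (w ∶ B) ∷ Δ → N ⊢ Γ ⇒ (w ∶ Or A B) ∷ Δ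
  L⊃ : ∀ {w A B Γ Δ} → N ⊢ Γ ⇒ (w ∶ A) ∷ Δ → N ⊢ F (w ∶ B) ∷ Γ ⇒ Δ → N ⊢ F (w ∶ Imp A B) ∷ Γ ⇒ Δ
  R⊃ : ∀ {w A B Γ Δ} → N ⊢ F (w ∶ A) ∷ Γ ⇒ (w ∶ B) ∷ Δ → N ⊢ Γ ⇒ (w ∶ Imp A B) ∷ Δ
  L∀ : ∀ {w A y Γ Δ} → N ⊢ F (w ∶ inst A y) ∷ dom y w ∷ F (w ∶ All A) ∷ Γ ⇒ Δ
                     → N ⊢ dom y w ∷ F (w ∶ All A) ∷ Γ ⇒ Δ
  R∀ : ∀ {w A z Γ Δ} → FreshVar z Γ ((w ∶ All A) ∷ Δ)
                     → N ⊢ dom z w ∷ Γ ⇒ (w ∶ inst A z) ∷ Δ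
                     → N ⊢ Γ ⇒ (w ∶ All A) ∷ Δ
  L∃ : ∀ {w A z Γ Δ} → FreshVar z (F (w ∶ Ex A) ∷ Γ) Δ
                     → N ⊢ dom z w ∷ F (w ∶ inst A z) ∷ Γ ⇒ Δ
                     → N ⊢ F (w ∶ Ex A) ∷ Γ ⇒ Δ
  R∃ : ∀ {w A y Γ Δ} → N ⊢ dom y w ∷ Γ ⇒ (w ∶ Ex A) ∷ (w ∶ inst A y) ∷ Δ
                     → N ⊢ dom y w ∷ Γ ⇒ (w ∶ Ex A) ∷ Δ
  L□ : ∀ {w v A Γ Δ} → N ⊢ F (v ∶ A) ∷ rel w v ∷ F (w ∶ Box A) ∷ Γ ⇒ Δ
                     → N ⊢ rel w v ∷ F (w ∶ Box A) ∷ Γ ⇒ Δ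
  R□ : ∀ {w u A Γ Δ} → FreshLab u Γ ((w ∶ Box A) ∷ Δ)
                     → N ⊢ rel w u ∷ Γ ⇒ (u ∶ A) ∷ Δ
                     → N ⊢ Γ ⇒ (w ∶ Box A) ∷ Δ
  L◇ : ∀ {w u A Γ Δ} → FreshLab u (F (w ∶ Dia A) ∷ Γ) Δ
                     → N ⊢ rel w u ∷ F (u ∶ A) ∷ Γ ⇒ Δ
                     → N ⊢ F (w ∶ Dia A) ∷ Γ ⇒ Δ
  R◇ : ∀ {w v A Γ Δ} → N ⊢ rel w v ∷ Γ ⇒ (w ∶ Dia A) ∷ (v ∶ A) ∷ Δ
                     → N ⊢ rel w v ∷ Γ ⇒ (w ∶ Dia A) ∷ Δ
  Ref= : ∀ {w x Γ Δ} → N ⊢ F (w ∶ eqv x x) ∷ Γ ⇒ Δ → N ⊢ Γ ⇒ Δ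
  RigVar : ∀ {w v y z Γ Δ} → N ⊢ F (v ∶ eqv y z) ∷ F (w ∶ eqv y z) ∷ Γ ⇒ Δ
                           → N ⊢ F (w ∶ eqv y z) ∷ Γ ⇒ Δ
  Repl : ∀ {w E x y z Γ Δ} → ReplItem w E
         → N ⊢ subL z x E ∷ subL y x E ∷ F (w ∶ eqv y z) ∷ Γ ⇒ Δ
         → N ⊢ subL y x E ∷ F (w ∶ eqv y z) ∷ Γ ⇒ Δ
  Lλ : ∀ {w B t z Γ Δ} → FreshVar z (F (w ∶ Lam B t) ∷ Γ) Δ
                       → N ⊢ F (D t z w) ∷ F (w ∶ inst B z) ∷ Γ ⇒ Δ
                       → N ⊢ F (w ∶ Lam B t) ∷ Γ ⇒ Δ
  Rλ : ∀ {w B t y Γ Δ} → N ⊢ Γ ⇒ (w ∶ Lam B t) ∷ D t y w ∷ Δ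
                       → N ⊢ Γ ⇒ (w ∶ Lam B t) ∷ (w ∶ inst B y) ∷ Δ
                       → N ⊢ Γ ⇒ (w ∶ Lam B t) ∷ Δ
  LD₁ : ∀ {w A x₂ Γ Δ} → N ⊢ F (w ∶ inst A x₂) ∷ F (D (iota A) x₂ w) ∷ Γ ⇒ Δ
                       → N ⊢ F (D (iota A) x₂ w) ∷ Γ ⇒ Δ
  LD₂ : ∀ {w A x₂ y Γ Δ} → N ⊢ F (D (iota A) x₂ w) ∷ Γ ⇒ (w ∶ inst A y) ∷ Δ
                         → N ⊢ F (w ∶ eqv x₂ y) ∷ F (D (iota A) x₂ w) ∷ Γ ⇒ Δ
                         → N ⊢ F (D (iota A) x₂ w) ∷ Γ ⇒ Δ
  RD : ∀ {w A x₂ z Γ Δ} → FreshVar z Γ (D (iota A) x₂ w ∷ Δ)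
                        → N ⊢ Γ ⇒ (w ∶ inst A x₂) ∷ Δ
                        → N ⊢ F (w ∶ inst A z) ∷ Γ ⇒ (w ∶ eqv x₂ z) ∷ Δ
                        → N ⊢ Γ ⇒ D (iota A) x₂ w ∷ Δ
  DenVar : ∀ {w x Γ Δ} → N ⊢ F (D (var (fv x)) x w) ∷ Γ ⇒ Δ → N ⊢ Γ ⇒ Δ
  DenId : ∀ {w x y Γ Δ} → N ⊢ F (w ∶ eqv y x) ∷ F (D (var (fv y)) x w) ∷ Γ ⇒ Δ
                        → N ⊢ F (D (var (fv y)) x w) ∷ Γ ⇒ Δ
  RefWR : ∀ {w Γ Δ} → RefW ∈ N → N ⊢ rel w w ∷ Γ ⇒ Δ → N ⊢ Γ ⇒ Δ
  SerR : ∀ {w u Γ Δ} → Ser ∈ N → FreshLab u Γ Δ → N ⊢ rel w u ∷ Γ ⇒ Δ → N ⊢ Γ ⇒ Δ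
  TransR : ∀ {w v u Γ Δ} → Trans ∈ N → N ⊢ rel w u ∷ rel w v ∷ rel v u ∷ Γ ⇒ Δ
                         → N ⊢ rel w v ∷ rel v u ∷ Γ ⇒ Δ
  EuclR : ∀ {w v u Γ Δ} → Eucl ∈ N → N ⊢ rel v u ∷ rel w v ∷ rel w u ∷ Γ ⇒ Δ
                        → N ⊢ rel w v ∷ rel w u ∷ Γ ⇒ Δ
  EuclcR : ∀ {w v Γ Δ} → Eucl ∈ N → N ⊢ rel v v ∷ rel w v ∷ Γ ⇒ Δ
                       → N ⊢ rel w v ∷ Γ ⇒ Δ
  IncrR : ∀ {x w v Γ Δ} → Incr ∈ N → N ⊢ dom x v ∷ dom x w ∷ rel w v ∷ Γ ⇒ Δ
                        → N ⊢ dom x w ∷ rel w v ∷ Γ ⇒ Δ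
  DecrR : ∀ {x w v Γ Δ} → Decr ∈ N → N ⊢ dom x w ∷ dom x v ∷ rel w v ∷ Γ ⇒ Δ
                        → N ⊢ dom x v ∷ rel w v ∷ Γ ⇒ Δ
  ConsR : ∀ {x w Γ Δ} → Cons ∈ N → N ⊢ dom x w ∷ Γ ⇒ Δ → N ⊢ Γ ⇒ Δ

module Submission where

-- The whole theorem rests on one transfer principle, the simulation lemma: if
-- Γ ⇒ Δ is derivable, so is every target T ⇒ TD into which a renaming of
-- Γ ⇒ Δ embeds.  An embedding realises each source expression in the target by
-- copying it, by sharing a persistent copy, by an inversion step, or by a
-- replacement a ⇝ b justified by an identity a = b at the same label.  The
-- lemma is proved by induction on the derivation, with one case per rule;
-- eigenvariables and eigenlabels are renamed to fresh ones, which is why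
-- renamings are built in.
-- Replacement for arbitrary formulas and the admissibility of Repl₁ and Repl₂
-- are then direct transfers, and the theorem collects them.

open import Defs
open import Data.Bool using (true; false; T)
open import Data.Unit using (tt)
open import Data.Nat using (ℕ; zero; suc; _≟_; _≡ᵇ_; _+_; _≤_; s≤s)
open import Data.Nat.Properties using (≤-refl; ≤-trans; m≤m+n; m≤n+m; <-irrefl; ≤-reflexive; ≡ᵇ⇒≡; ≡⇒≡ᵇ)
open import Data.Fin using (Fin; zero; suc)
open import Data.List using (List; []; _∷_; _++_; map)
open import Data.Nat.ListAction using (sum)
open import Data.List.Properties using (++-assoc; ++-identityʳ; map-∘; map-cong; map-id)
open import Data.List.Membership.Propositional using (_∈_; _∉_)
open import Data.List.Membership.Propositional.Properties using (∈-++⁺ˡ; ∈-++⁺ʳ; ∈-∃++)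
open import Data.List.Relation.Unary.Any using (here; there)
open import Data.List.Relation.Binary.Pointwise using (Pointwise; []; _∷_)
open import Data.List.Relation.Binary.Permutation.Propositional using (_↭_; ↭-sym; ↭-trans; ↭-refl; ↭-prep; ↭-swap; ↭-reflexive)
import Data.List.Relation.Binary.Permutation.Propositional as Perm
open import Data.List.Relation.Binary.Permutation.Propositional.Properties using (shift; shifts; ++⁺ˡ; ∈-resp-↭; map⁺)
open import Data.Sum using (_⊎_; inj₁; inj₂)
open import Data.Product using (Σ; _×_; _,_; proj₂)
open import Data.Empty using (⊥-elim)
open import Relation.Nullary using (¬_; yes; no)
open import Relation.Binary.PropositionalEquality

fren : ∀ {n} → (ℕ → ℕ) → V n → V n
fren s (fv x) = fv (s x)
fren s (bv i) = bv i

liftR-wk : ∀ {m n} (ρ : V m → V n) u → liftR ρ (wkV u) ≡ wkV (ρ u)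
liftR-wk ρ (fv x) = refl
liftR-wk ρ (bv i) = refl

record VExt {m n} (ρ1 ρ2 : V m → V n) (xs : List Var) : Set where
  constructor vext
  field
    vf : ∀ x → x ∈ xs → ρ1 (fv x) ≡ ρ2 (fv x)
    vb : ∀ (i : Fin m) → ρ1 (bv i) ≡ ρ2 (bv i)

liftExt : ∀ {m n} {ρ1 ρ2 : V m → V n} {xs} → VExt ρ1 ρ2 xs → VExt (liftR ρ1) (liftR ρ2) xs
liftExt (vext h hb) = vext (λ x m → cong wkV (h x m)) λ { zero → refl ; (suc i) → cong wkV (hb i) }

subExt : ∀ {m n} {ρ1 ρ2 : V m → V n} {xs ys} → (∀ {x} → x ∈ ys → x ∈ xs) → VExt ρ1 ρ2 xs → VExt ρ1 ρ2 ys
subExt f (vext h hb) = vext (λ x m → h x (f m)) hb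

extV : ∀ {m n} {ρ1 ρ2 : V m → V n} (v : V m) → VExt ρ1 ρ2 (varsV v) → ρ1 v ≡ ρ2 v
extV (fv x) (vext h hb) = h x (here refl)
extV (bv i) (vext h hb) = hb i

extVs : ∀ {m n} {ρ1 ρ2 : V m → V n} (vs : List (V m)) → VExt ρ1 ρ2 (varsVs vs) → map ρ1 vs ≡ map ρ2 vs
extVs [] e = refl
extVs (v ∷ vs) e = cong₂ _∷_ (extV v (subExt ∈-++⁺ˡ e)) (extVs vs (subExt (∈-++⁺ʳ (varsV v)) e))

mutual
  extT : ∀ {m n} {ρ1 ρ2 : V m → V n} (t : Term m) → VExt ρ1 ρ2 (varsT t) → renT ρ1 t ≡ renT ρ2 t
  extT (var v) e = cong var (extV v e)
  extT (iota A) e = cong iota (extF A (liftExt e))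

  extF : ∀ {m n} {ρ1 ρ2 : V m → V n} (A : Form m) → VExt ρ1 ρ2 (varsF A) → renF ρ1 A ≡ renF ρ2 A
  extF (Pr P xs) e = cong (Pr P) (extVs xs e)
  extF (Eq x y) e = cong₂ Eq (extV x (subExt ∈-++⁺ˡ e)) (extV y (subExt (∈-++⁺ʳ (varsV x)) e))
  extF Bot e = refl
  extF (And A B) e = cong₂ And (extF A (subExt ∈-++⁺ˡ e)) (extF B (subExt (∈-++⁺ʳ (varsF A)) e))
  extF (Or A B) e = cong₂ Or (extF A (subExt ∈-++⁺ˡ e)) (extF B (subExt (∈-++⁺ʳ (varsF A)) e))
  extF (Imp A B) e = cong₂ Imp (extF A (subExt ∈-++⁺ˡ e)) (extF B (subExt (∈-++⁺ʳ (varsF A)) e))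
  extF (All A) e = cong All (extF A (liftExt e))
  extF (Ex A) e = cong Ex (extF A (liftExt e))
  extF (Box A) e = cong Box (extF A e)
  extF (Dia A) e = cong Dia (extF A e)
  extF (Lam A t) e = cong₂ Lam (extF A (liftExt (subExt ∈-++⁺ˡ e))) (extT t (subExt (∈-++⁺ʳ (varsF A)) e))

fullExt : ∀ {m n} {ρ1 ρ2 : V m → V n} {xs} → (∀ v → ρ1 v ≡ ρ2 v) → VExt ρ1 ρ2 xs
fullExt h = vext (λ x _ → h (fv x)) λ i → h (bv i)

liftFuse : ∀ {k m n} (ρ1 : V m → V n) (ρ2 : V k → V m) v → liftR ρ1 (liftR ρ2 v) ≡ liftR (λ u → ρ1 (ρ2 u)) v
liftFuse ρ1 ρ2 (fv x) = liftR-wk ρ1 (ρ2 (fv x))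
liftFuse ρ1 ρ2 (bv zero) = refl
liftFuse ρ1 ρ2 (bv (suc i)) = liftR-wk ρ1 (ρ2 (bv i))

mutual
  fuseT : ∀ {k m n} (ρ1 : V m → V n) (ρ2 : V k → V m) (t : Term k) → renT ρ1 (renT ρ2 t) ≡ renT (λ u → ρ1 (ρ2 u)) t
  fuseT ρ1 ρ2 (var v) = refl
  fuseT ρ1 ρ2 (iota A) = cong iota (trans (fuseF (liftR ρ1) (liftR ρ2) A) (extF A (fullExt (liftFuse ρ1 ρ2))))

  fuseF : ∀ {k m n} (ρ1 : V m → V n) (ρ2 : V k → V m) (A : Form k) → renF ρ1 (renF ρ2 A) ≡ renF (λ u → ρ1 (ρ2 u)) A
  fuseF ρ1 ρ2 (Pr P xs) = cong (Pr P) (sym (map-∘ xs))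
  fuseF ρ1 ρ2 (Eq x y) = refl
  fuseF ρ1 ρ2 Bot = refl
  fuseF ρ1 ρ2 (And A B) = cong₂ And (fuseF ρ1 ρ2 A) (fuseF ρ1 ρ2 B)
  fuseF ρ1 ρ2 (Or A B) = cong₂ Or (fuseF ρ1 ρ2 A) (fuseF ρ1 ρ2 B)
  fuseF ρ1 ρ2 (Imp A B) = cong₂ Imp (fuseF ρ1 ρ2 A) (fuseF ρ1 ρ2 B)
  fuseF ρ1 ρ2 (All A) = cong All (trans (fuseF (liftR ρ1) (liftR ρ2) A) (extF A (fullExt (liftFuse ρ1 ρ2))))
  fuseF ρ1 ρ2 (Ex A) = cong Ex (trans (fuseF (liftR ρ1) (liftR ρ2) A) (extF A (fullExt (liftFuse ρ1 ρ2))))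
  fuseF ρ1 ρ2 (Box A) = cong Box (fuseF ρ1 ρ2 A)
  fuseF ρ1 ρ2 (Dia A) = cong Dia (fuseF ρ1 ρ2 A)
  fuseF ρ1 ρ2 (Lam A t) = cong₂ Lam (trans (fuseF (liftR ρ1) (liftR ρ2) A) (extF A (fullExt (liftFuse ρ1 ρ2)))) (fuseT ρ1 ρ2 t)

renInst : ∀ (s : ℕ → ℕ) (A : Form 1) y → renF (fren s) (inst A y) ≡ inst (renF (liftR (fren s)) A) (s y)
renInst s A y = trans (fuseF (fren s) (instV (fv y)) A)
                 (trans (extF A (fullExt h)) (sym (fuseF (instV (fv (s y))) (liftR (fren s)) A)))
  where
  h : ∀ (v : V 1) → fren s (instV (fv y) v) ≡ instV (fv (s y)) (liftR (fren s) v)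
  h (fv x) = refl
  h (bv zero) = refl
  h (bv (suc ()))

-- upd s z z' is s, except that it sends z to z'.  Updated renamings are used to
-- rename an eigenvariable or eigenlabel of a premise to one fresh for the target.
upd : (ℕ → ℕ) → ℕ → ℕ → ℕ → ℕ
upd s z z' u with u ≟ z
... | yes _ = z'
... | no _ = s u

upd-here : ∀ s z z' → upd s z z' z ≡ z'
upd-here s z z' with z ≟ z
... | yes _ = refl
... | no ne = ⊥-elim (ne refl)

upd-there : ∀ s z z' u → ¬ u ≡ z → upd s z z' u ≡ s u
upd-there s z z' u ne with u ≟ z
... | yes e = ⊥-elim (ne e)
... | no _ = refl

ne-of-∉ : ∀ {u w : ℕ} {xs} → u ∉ xs → w ∈ xs → ¬ w ≡ u
ne-of-∉ nu m refl = nu m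

updExt : ∀ {m} s z z' {xs} → z ∉ xs → VExt {m} (fren (upd s z z')) (fren s) xs
updExt s z z' nz = vext (λ x m → cong fv (upd-there s z z' x (ne-of-∉ nz m))) λ i → refl

updF : ∀ {m} s z z' (A : Form m) → z ∉ varsF A → renF (fren (upd s z z')) A ≡ renF (fren s) A
updF s z z' A nz = extF A (updExt s z z' nz)

updT : ∀ {m} s z z' (t : Term m) → z ∉ varsT t → renT (fren (upd s z z')) t ≡ renT (fren s) t
updT s z z' t nz = extT t (updExt s z z' nz)

fresh : List ℕ → ℕ
fresh xs = suc (sum xs)

≤sum : ∀ {x xs} → x ∈ xs → x ≤ sum xs
≤sum {x} {y ∷ xs} (here refl) = m≤m+n x (sum xs)
≤sum {x} {y ∷ xs} (there m) = ≤-trans (≤sum m) (m≤n+m (sum xs) y)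

fresh∉ : ∀ xs → fresh xs ∉ xs
fresh∉ xs m = lem (≤sum m)
  where
  lem : ¬ suc (sum xs) ≤ sum xs
  lem p = <-irrefl refl p

-- VarRep a b u u' (and its extensions to terms,
-- formulas and labelled formulas) holds when u' arises from u by replacing some of
-- the free occurrences of a by b.  This is the relation that an identity a = b
-- lets us cross, generalising the atomic rule Repl to arbitrary formulas.
data VarRep {n} (a b : Var) : V n → V n → Set where
  vsame : ∀ v → VarRep a b v v
  vab : VarRep a b (fv a) (fv b)

mutual
  data TermRep {n} (a b : Var) : Term n → Term n → Set where
    tvar : ∀ {u u'} → VarRep a b u u' → TermRep a b (var u) (var u')
    tiota : ∀ {A A'} → FormRep a b A A' → TermRep a b (iota A) (iota A')

  data FormRep {n} (a b : Var) : Form n → Form n → Set where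
    fpr : ∀ P {xs ys} → Pointwise (VarRep a b) xs ys → FormRep a b (Pr P xs) (Pr P ys)
    feq : ∀ {x x' y y'} → VarRep a b x x' → VarRep a b y y' → FormRep a b (Eq x y) (Eq x' y')
    fbot : FormRep a b Bot Bot
    fand : ∀ {A A' B B'} → FormRep a b A A' → FormRep a b B B' → FormRep a b (And A B) (And A' B')
    for : ∀ {A A' B B'} → FormRep a b A A' → FormRep a b B B' → FormRep a b (Or A B) (Or A' B')
    fimp : ∀ {A A' B B'} → FormRep a b A A' → FormRep a b B B' → FormRep a b (Imp A B) (Imp A' B')
    fall : ∀ {A A'} → FormRep a b A A' → FormRep a b (All A) (All A')
    fex : ∀ {A A'} → FormRep a b A A' → FormRep a b (Ex A) (Ex A')
    fbox : ∀ {A A'} → FormRep a b A A' → FormRep a b (Box A) (Box A')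
    fdia : ∀ {A A'} → FormRep a b A A' → FormRep a b (Dia A) (Dia A')
    flam : ∀ {A A' t t'} → FormRep a b A A' → TermRep a b t t' → FormRep a b (Lam A t) (Lam A' t')

RepMap : ∀ {m n} a b a' b' → (V m → V n) → (V m → V n) → Set
RepMap a b a' b' ρ1 ρ2 = ∀ {u u'} → VarRep a b u u' → VarRep a' b' (ρ1 u) (ρ2 u')

wkVR : ∀ {n a b} {u u' : V n} → VarRep a b u u' → VarRep a b (wkV u) (wkV u')
wkVR (vsame v) = vsame _
wkVR vab = vab

liftVR : ∀ {m n a b a' b'} {ρ1 ρ2 : V m → V n} → RepMap a b a' b' ρ1 ρ2 → RepMap a b a' b' (liftR ρ1) (liftR ρ2)
liftVR h (vsame (fv x)) = wkVR (h (vsame (fv x)))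
liftVR h (vsame (bv zero)) = vsame _
liftVR h (vsame (bv (suc i))) = wkVR (h (vsame (bv i)))
liftVR h vab = wkVR (h vab)

mapVR : ∀ {m n a b a' b'} {ρ1 ρ2 : V m → V n} → RepMap a b a' b' ρ1 ρ2 → ∀ {xs ys} →
        Pointwise (VarRep a b) xs ys → Pointwise (VarRep a' b') (map ρ1 xs) (map ρ2 ys)
mapVR h [] = []
mapVR h (r ∷ rs) = h r ∷ mapVR h rs

mutual
  renTR : ∀ {m n a b a' b'} {ρ1 ρ2 : V m → V n} → RepMap a b a' b' ρ1 ρ2 → ∀ {t t'} → TermRep a b t t' → TermRep a' b' (renT ρ1 t) (renT ρ2 t')
  renTR h (tvar r) = tvar (h r)
  renTR h (tiota r) = tiota (renFR (liftVR h) r)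

  renFR : ∀ {m n a b a' b'} {ρ1 ρ2 : V m → V n} → RepMap a b a' b' ρ1 ρ2 → ∀ {A A'} → FormRep a b A A' → FormRep a' b' (renF ρ1 A) (renF ρ2 A')
  renFR h (fpr P rs) = fpr P (mapVR h rs)
  renFR h (feq r1 r2) = feq (h r1) (h r2)
  renFR h fbot = fbot
  renFR h (fand r1 r2) = fand (renFR h r1) (renFR h r2)
  renFR h (for r1 r2) = for (renFR h r1) (renFR h r2)
  renFR h (fimp r1 r2) = fimp (renFR h r1) (renFR h r2)
  renFR h (fall r) = fall (renFR (liftVR h) r)
  renFR h (fex r) = fex (renFR (liftVR h) r)
  renFR h (fbox r) = fbox (renFR h r)
  renFR h (fdia r) = fdia (renFR h r)
  renFR h (flam r1 r2) = flam (renFR (liftVR h) r1) (renTR h r2)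

mutual
  reflT : ∀ {n a b} (t : Term n) → TermRep a b t t
  reflT (var v) = tvar (vsame v)
  reflT (iota A) = tiota (reflF A)

  reflVs : ∀ {n a b} (xs : List (V n)) → Pointwise (VarRep a b) xs xs
  reflVs [] = []
  reflVs (x ∷ xs) = vsame x ∷ reflVs xs

  reflF : ∀ {n a b} (A : Form n) → FormRep a b A A
  reflF (Pr P xs) = fpr P (reflVs xs)
  reflF (Eq x y) = feq (vsame x) (vsame y)
  reflF Bot = fbot
  reflF (And A B) = fand (reflF A) (reflF B)
  reflF (Or A B) = for (reflF A) (reflF B)
  reflF (Imp A B) = fimp (reflF A) (reflF B)
  reflF (All A) = fall (reflF A)
  reflF (Ex A) = fex (reflF A)
  reflF (Box A) = fbox (reflF A)
  reflF (Dia A) = fdia (reflF A)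
  reflF (Lam A t) = flam (reflF A) (reflT t)

flipV : ∀ {n a b} {u u' : V n} → VarRep a b u u' → VarRep b a u' u
flipV (vsame v) = vsame v
flipV vab = vab

flipVs : ∀ {n a b} {xs ys : List (V n)} → Pointwise (VarRep a b) xs ys → Pointwise (VarRep b a) ys xs
flipVs [] = []
flipVs (r ∷ rs) = flipV r ∷ flipVs rs

mutual
  flipT : ∀ {n a b} {t t' : Term n} → TermRep a b t t' → TermRep b a t' t
  flipT (tvar r) = tvar (flipV r)
  flipT (tiota r) = tiota (flipF r)

  flipF : ∀ {n a b} {A A' : Form n} → FormRep a b A A' → FormRep b a A' A
  flipF (fpr P rs) = fpr P (flipVs rs)
  flipF (feq r1 r2) = feq (flipV r1) (flipV r2)
  flipF fbot = fbot
  flipF (fand r1 r2) = fand (flipF r1) (flipF r2)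
  flipF (for r1 r2) = for (flipF r1) (flipF r2)
  flipF (fimp r1 r2) = fimp (flipF r1) (flipF r2)
  flipF (fall r) = fall (flipF r)
  flipF (fex r) = fex (flipF r)
  flipF (fbox r) = fbox (flipF r)
  flipF (fdia r) = fdia (flipF r)
  flipF (flam r1 r2) = flam (flipF r1) (flipT r2)

instVR : ∀ {a b u u'} → VarRep a b (fv u) (fv u') → RepMap {1} a b a b (instV (fv u)) (instV (fv u'))
instVR r (vsame (fv x)) = vsame _
instVR r (vsame (bv zero)) = r
instVR r (vsame (bv (suc ())))
instVR r vab = vab

instFR : ∀ {a b u u'} {A A' : Form 1} → VarRep a b (fv u) (fv u') → FormRep a b A A' → FormRep a b (inst A u) (inst A' u')
instFR r fr = renFR (instVR r) fr

frenVR : ∀ {n a b} s → RepMap {n} a b (s a) (s b) (fren s) (fren s)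
frenVR s (vsame (fv x)) = vsame _
frenVR s (vsame (bv i)) = vsame _
frenVR s vab = vab

-- A[z/x] and A[y/x] are related by a (z, y)-replacement; this is the form in
-- which the theorem states its replacement properties.
subVR : ∀ {n} z y x → RepMap {n} x x z y (fsubV z x) (fsubV y x)
subVR z y x (vsame (fv u)) with u ≡ᵇ x
... | true = vab
... | false = vsame _
subVR z y x (vsame (bv i)) = vsame _
subVR z y x vab with x ≡ᵇ x
... | true = vab
... | false = vsame _

-- Logical size of terms and formulas (atoms have size 0); the induction
-- measure for the generalised initial sequents and for contraction.
mutual
  sizeT : ∀ {n} → Term n → ℕ
  sizeT (var v) = 0
  sizeT (iota A) = suc (sizeF A)

  sizeF : ∀ {n} → Form n → ℕ
  sizeF (Pr P xs) = 0
  sizeF (Eq x y) = 0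
  sizeF Bot = 0
  sizeF (And A B) = suc (sizeF A + sizeF B)
  sizeF (Or A B) = suc (sizeF A + sizeF B)
  sizeF (Imp A B) = suc (sizeF A + sizeF B)
  sizeF (All A) = suc (sizeF A)
  sizeF (Ex A) = suc (sizeF A)
  sizeF (Box A) = suc (sizeF A)
  sizeF (Dia A) = suc (sizeF A)
  sizeF (Lam A t) = suc (sizeF A + sizeT t)

mutual
  sizeRenT : ∀ {m n} (ρ : V m → V n) (t : Term m) → sizeT (renT ρ t) ≡ sizeT t
  sizeRenT ρ (var v) = refl
  sizeRenT ρ (iota A) = cong suc (sizeRenF (liftR ρ) A)

  sizeRenF : ∀ {m n} (ρ : V m → V n) (A : Form m) → sizeF (renF ρ A) ≡ sizeF A
  sizeRenF ρ (Pr P xs) = refl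
  sizeRenF ρ (Eq x y) = refl
  sizeRenF ρ Bot = refl
  sizeRenF ρ (And A B) = cong₂ (λ p q → suc (p + q)) (sizeRenF ρ A) (sizeRenF ρ B)
  sizeRenF ρ (Or A B) = cong₂ (λ p q → suc (p + q)) (sizeRenF ρ A) (sizeRenF ρ B)
  sizeRenF ρ (Imp A B) = cong₂ (λ p q → suc (p + q)) (sizeRenF ρ A) (sizeRenF ρ B)
  sizeRenF ρ (All A) = cong suc (sizeRenF (liftR ρ) A)
  sizeRenF ρ (Ex A) = cong suc (sizeRenF (liftR ρ) A)
  sizeRenF ρ (Box A) = cong suc (sizeRenF ρ A)
  sizeRenF ρ (Dia A) = cong suc (sizeRenF ρ A)
  sizeRenF ρ (Lam A t) = cong₂ (λ p q → suc (p + q)) (sizeRenF (liftR ρ) A) (sizeRenT ρ t)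

sizeInst : ∀ (A : Form 1) y → sizeF (inst A y) ≡ sizeF A
sizeInst A y = sizeRenF (instV (fv y)) A

svar-ne : ∀ {y x z} → ¬ z ≡ x → svar y x z ≡ z
svar-ne {y} {x} {z} ne with z ≡ᵇ x in eq
... | true = ⊥-elim (ne (≡ᵇ⇒≡ z x (subst T (sym eq) tt)))
... | false = refl

svar-eq : ∀ {y x} → svar y x x ≡ y
svar-eq {y} {x} with x ≡ᵇ x in eq
... | true = refl
... | false = ⊥-elim (subst T eq (≡⇒≡ᵇ x x refl))

record Ren : Set where
  constructor mkRen
  field
    vs : ℕ → ℕ
    ls : ℕ → ℕ
open Ren public

renFm : Ren → Fm → Fm
renFm σ (w ∶ A) = ls σ w ∶ renF (fren (vs σ)) A
renFm σ (D t x w) = D (renT (fren (vs σ)) t) (vs σ x) (ls σ w)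

renItem : Ren → LItem → LItem
renItem σ (F f) = F (renFm σ f)
renItem σ (dom x w) = dom (vs σ x) (ls σ w)
renItem σ (rel w v) = rel (ls σ w) (ls σ v)

updVar : Ren → ℕ → ℕ → Ren
updVar σ z z' = mkRen (upd (vs σ) z z') (ls σ)

updLab : Ren → ℕ → ℕ → Ren
updLab σ u u' = mkRen (vs σ) (upd (ls σ) u u')

∉++ˡ : ∀ {z : ℕ} {xs ys} → z ∉ xs ++ ys → z ∉ xs
∉++ˡ n m = n (∈-++⁺ˡ m)

∉++ʳ : ∀ {z : ℕ} xs {ys} → z ∉ xs ++ ys → z ∉ ys
∉++ʳ xs n m = n (∈-++⁺ʳ xs m)

updVFm : ∀ σ z z' f → z ∉ varsFm f → renFm (updVar σ z z') f ≡ renFm σ f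
updVFm σ z z' (w ∶ A) nz = cong (ls σ w ∶_) (updF (vs σ) z z' A nz)
updVFm σ z z' (D t x w) nz =
  cong₂ (λ p q → D p q (ls σ w)) (updT (vs σ) z z' t (∉++ˡ nz))
    (upd-there (vs σ) z z' x (λ e → ∉++ʳ (varsT t) nz (here (sym e))))

updVL : ∀ σ z z' x → z ∉ varsL x → renItem (updVar σ z z') x ≡ renItem σ x
updVL σ z z' (F f) nz = cong F (updVFm σ z z' f nz)
updVL σ z z' (dom x w) nz = cong (λ p → dom p (ls σ w)) (upd-there (vs σ) z z' x (λ e → nz (here (sym e))))
updVL σ z z' (rel w v) nz = refl

updVLs : ∀ σ z z' Γ → z ∉ concatMapL varsL Γ → map (renItem (updVar σ z z')) Γ ≡ map (renItem σ) Γ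
updVLs σ z z' [] nz = refl
updVLs σ z z' (x ∷ Γ) nz = cong₂ _∷_ (updVL σ z z' x (∉++ˡ nz)) (updVLs σ z z' Γ (∉++ʳ (varsL x) nz))

updVFms : ∀ σ z z' Δ → z ∉ concatMapL varsFm Δ → map (renFm (updVar σ z z')) Δ ≡ map (renFm σ) Δ
updVFms σ z z' [] nz = refl
updVFms σ z z' (x ∷ Δ) nz = cong₂ _∷_ (updVFm σ z z' x (∉++ˡ nz)) (updVFms σ z z' Δ (∉++ʳ (varsFm x) nz))

updLFm : ∀ σ u u' f → u ∉ labsFm f → renFm (updLab σ u u') f ≡ renFm σ f
updLFm σ u u' (w ∶ A) nu = cong (_∶ renF (fren (vs σ)) A) (upd-there (ls σ) u u' w (ne-of-∉ nu (here refl)))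
updLFm σ u u' (D t x w) nu = cong (D (renT (fren (vs σ)) t) (vs σ x)) (upd-there (ls σ) u u' w (ne-of-∉ nu (here refl)))

updLL : ∀ σ u u' x → u ∉ labsL x → renItem (updLab σ u u') x ≡ renItem σ x
updLL σ u u' (F f) nu = cong F (updLFm σ u u' f nu)
updLL σ u u' (dom x w) nu = cong (dom (vs σ x)) (upd-there (ls σ) u u' w (ne-of-∉ nu (here refl)))
updLL σ u u' (rel w v) nu = cong₂ rel (upd-there (ls σ) u u' w (ne-of-∉ nu (here refl)))
                                       (upd-there (ls σ) u u' v (ne-of-∉ nu (there (here refl))))

updLLs : ∀ σ u u' Γ → u ∉ concatMapL labsL Γ → map (renItem (updLab σ u u')) Γ ≡ map (renItem σ) Γ
updLLs σ u u' [] nu = refl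
updLLs σ u u' (x ∷ Γ) nu = cong₂ _∷_ (updLL σ u u' x (∉++ˡ nu)) (updLLs σ u u' Γ (∉++ʳ (labsL x) nu))

updLFms : ∀ σ u u' Δ → u ∉ concatMapL labsFm Δ → map (renFm (updLab σ u u')) Δ ≡ map (renFm σ) Δ
updLFms σ u u' [] nu = refl
updLFms σ u u' (x ∷ Δ) nu = cong₂ _∷_ (updLFm σ u u' x (∉++ˡ nu)) (updLFms σ u u' Δ (∉++ʳ (labsFm x) nu))

idLift : ∀ {n} {ρ : V n → V n} → (∀ v → ρ v ≡ v) → ∀ v → liftR ρ v ≡ v
idLift h (fv x) = cong wkV (h (fv x))
idLift h (bv zero) = refl
idLift h (bv (suc i)) = cong wkV (h (bv i))

mutual
  renT-id : ∀ {n} {ρ : V n → V n} → (∀ v → ρ v ≡ v) → ∀ t → renT ρ t ≡ t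
  renT-id h (var v) = cong var (h v)
  renT-id h (iota A) = cong iota (renF-id (idLift h) A)

  renF-id : ∀ {n} {ρ : V n → V n} → (∀ v → ρ v ≡ v) → ∀ A → renF ρ A ≡ A
  renF-id h (Pr P xs) = cong (Pr P) (trans (map-cong h xs) (map-id xs))
  renF-id h (Eq x y) = cong₂ Eq (h x) (h y)
  renF-id h Bot = refl
  renF-id h (And A B) = cong₂ And (renF-id h A) (renF-id h B)
  renF-id h (Or A B) = cong₂ Or (renF-id h A) (renF-id h B)
  renF-id h (Imp A B) = cong₂ Imp (renF-id h A) (renF-id h B)
  renF-id h (All A) = cong All (renF-id (idLift h) A)
  renF-id h (Ex A) = cong Ex (renF-id (idLift h) A)
  renF-id h (Box A) = cong Box (renF-id h A)
  renF-id h (Dia A) = cong Dia (renF-id h A)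
  renF-id h (Lam A t) = cong₂ Lam (renF-id (idLift h) A) (renT-id h t)

idRen : Ren
idRen = mkRen (λ x → x) (λ x → x)

fren-id : ∀ {n} (v : V n) → fren (λ x → x) v ≡ v
fren-id (fv x) = refl
fren-id (bv i) = refl

renFm-id : ∀ f → renFm idRen f ≡ f
renFm-id (w ∶ A) = cong (w ∶_) (renF-id fren-id A)
renFm-id (D t x w) = cong (λ q → D q x w) (renT-id fren-id t)

renItem-id : ∀ x → renItem idRen x ≡ x
renItem-id (F f) = cong F (renFm-id f)
renItem-id (dom x w) = refl
renItem-id (rel w v) = refl

mapRenItem-id : ∀ Γ → map (renItem idRen) Γ ≡ Γ
mapRenItem-id [] = refl
mapRenItem-id (x ∷ Γ) = cong₂ _∷_ (renItem-id x) (mapRenItem-id Γ)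

mapRenFm-id : ∀ Δ → map (renFm idRen) Δ ≡ Δ
mapRenFm-id [] = refl
mapRenFm-id (x ∷ Δ) = cong₂ _∷_ (renFm-id x) (mapRenFm-id Δ)

-- Persistent antecedent (PersL) and succedent (PersR) expressions: those whose
-- left (resp. right) rules keep the principal formula in the premise, or which are
-- never principal there.  A persistent expression may be shared by several
-- expressions of a source sequent, which is what makes contraction admissible.
data PersL : LItem → Set where
  pl-all : ∀ {w A} → PersL (F (w ∶ All A))
  pl-box : ∀ {w A} → PersL (F (w ∶ Box A))
  pl-pr : ∀ {w P xs} → PersL (F (w ∶ Pr P xs))
  pl-eq : ∀ {w x y} → PersL (F (w ∶ Eq x y))
  pl-bot : ∀ {w} → PersL (F (w ∶ Bot))
  pl-D : ∀ {t x w} → PersL (F (D t x w))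
  pl-dom : ∀ {x w} → PersL (dom x w)
  pl-rel : ∀ {w v} → PersL (rel w v)

data PersR : Fm → Set where
  pr-ex : ∀ {w A} → PersR (w ∶ Ex A)
  pr-dia : ∀ {w A} → PersR (w ∶ Dia A)
  pr-lam : ∀ {w A t} → PersR (w ∶ Lam A t)
  pr-pr : ∀ {w P xs} → PersR (w ∶ Pr P xs)
  pr-eq : ∀ {w x y} → PersR (w ∶ Eq x y)
  pr-bot : ∀ {w} → PersR (w ∶ Bot)
  pr-D : ∀ {v x w} → PersR (D (var v) x w)

SubL : List LItem → List LItem → Set
SubL M M' = ∀ {x} → PersL x → x ∈ M → x ∈ M'

SubR : List Fm → List Fm → Set
SubR M M' = ∀ {x} → PersR x → x ∈ M → x ∈ M'

labFm : Fm → Label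
labFm (w ∶ A) = w
labFm (D t x w) = w

data FmRep (a b : Var) : Fm → Fm → Set where
  fmF : ∀ {w A A'} → FormRep a b A A' → FmRep a b (w ∶ A) (w ∶ A')
  fmD : ∀ {w t t' x x'} → TermRep a b t t' → VarRep {0} a b (fv x) (fv x') → FmRep a b (D t x w) (D t' x' w)

EqAt : Fm → Var → Var → LItem
EqAt f a b = F (labFm f ∶ eqv a b)

-- How one antecedent expression x of the source sequent is realised in the
-- target, relative to a context M of target antecedent expressions: MatchL M x c d
-- says that x contributes c to the target antecedent and d to its succedent.  The
-- options are: share a persistent copy in M (mper), copy x (mcon), a left
-- inversion step (mand, mor1, mor2, mimp1, mimp2, and mex, mdia, mlam using a
-- witness already in M), or a replacement through an identity in M (mrep).
data MatchL (M : List LItem) : LItem → List LItem → List Fm → Set where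
  mper : ∀ {x} → PersL x → x ∈ M → MatchL M x [] []
  mcon : ∀ {x} → MatchL M x (x ∷ []) []
  mand : ∀ {w A B} → MatchL M (F (w ∶ And A B)) (F (w ∶ A) ∷ F (w ∶ B) ∷ []) []
  mor1 : ∀ {w A B} → MatchL M (F (w ∶ Or A B)) (F (w ∶ A) ∷ []) []
  mor2 : ∀ {w A B} → MatchL M (F (w ∶ Or A B)) (F (w ∶ B) ∷ []) []
  mimp1 : ∀ {w A B} → MatchL M (F (w ∶ Imp A B)) [] ((w ∶ A) ∷ [])
  mimp2 : ∀ {w A B} → MatchL M (F (w ∶ Imp A B)) (F (w ∶ B) ∷ []) []
  mex : ∀ {w A u} → dom u w ∈ M → MatchL M (F (w ∶ Ex A)) (F (w ∶ inst A u) ∷ []) []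
  mdia : ∀ {w A u} → rel w u ∈ M → MatchL M (F (w ∶ Dia A)) (F (u ∶ A) ∷ []) []
  mlam : ∀ {w A t u} → F (D t u w) ∈ M → MatchL M (F (w ∶ Lam A t)) (F (w ∶ inst A u) ∷ []) []
  mrep : ∀ {a b f f'} → FmRep a b f' f → EqAt f a b ∈ M → MatchL M (F f) (F f' ∷ []) []

data MatchR (M : List LItem) (MD : List Fm) : Fm → List LItem → List Fm → Set where
  rper : ∀ {y} → PersR y → y ∈ MD → MatchR M MD y [] []
  rcon : ∀ {y} → MatchR M MD y [] (y ∷ [])
  rand1 : ∀ {w A B} → MatchR M MD (w ∶ And A B) [] ((w ∶ A) ∷ [])
  rand2 : ∀ {w A B} → MatchR M MD (w ∶ And A B) [] ((w ∶ B) ∷ [])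
  ror : ∀ {w A B} → MatchR M MD (w ∶ Or A B) [] ((w ∶ A) ∷ (w ∶ B) ∷ [])
  rimp : ∀ {w A B} → MatchR M MD (w ∶ Imp A B) (F (w ∶ A) ∷ []) ((w ∶ B) ∷ [])
  rall : ∀ {w A u} → dom u w ∈ M → MatchR M MD (w ∶ All A) [] ((w ∶ inst A u) ∷ [])
  rbox : ∀ {w A u} → rel w u ∈ M → MatchR M MD (w ∶ Box A) [] ((u ∶ A) ∷ [])
  rrep : ∀ {a b f f'} → FmRep a b f f' → EqAt f a b ∈ M → MatchR M MD f [] (f' ∷ [])

data MatchLs (M : List LItem) : List LItem → List LItem → List Fm → Set where
  [] : MatchLs M [] [] []
  _∷_ : ∀ {x c d Γ cs ds} → MatchL M x c d → MatchLs M Γ cs ds → MatchLs M (x ∷ Γ) (c ++ cs) (d ++ ds)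

data MatchRs (M : List LItem) (MD : List Fm) : List Fm → List LItem → List Fm → Set where
  [] : MatchRs M MD [] [] []
  _∷_ : ∀ {y c d Δ cs ds} → MatchR M MD y c d → MatchRs M MD Δ cs ds → MatchRs M MD (y ∷ Δ) (c ++ cs) (d ++ ds)

-- Emb M MD T TD Γ Δ: the sequent Γ ⇒ Δ embeds into T ⇒ TD relative to the contexts
-- M, MD: the target is, up to permutation, the union of the contributions of all
-- matchings plus arbitrary extra expressions (weakening).
record Emb (M : List LItem) (MD : List Fm) (T : List LItem) (TD : List Fm) (Γ : List LItem) (Δ : List Fm) : Set where
  constructor emb
  field
    {cl1 cl2 LL} : List LItem
    {cr1 cr2 RR} : List Fm
    ml : MatchLs M Γ cl1 cr1
    mr : MatchRs M MD Δ cl2 cr2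
    pl : T ↭ cl1 ++ cl2 ++ LL
    pr : TD ↭ cr1 ++ cr2 ++ RR

-- Matchings and embeddings only depend on the persistent part of the context,
-- so they transfer along inclusions of persistent expressions.
trML : ∀ {M M' x c d} → SubL M M' → MatchL M x c d → MatchL M' x c d
trML s (mper p m) = mper p (s p m)
trML s mcon = mcon
trML s mand = mand
trML s mor1 = mor1
trML s mor2 = mor2
trML s mimp1 = mimp1
trML s mimp2 = mimp2
trML s (mex m) = mex (s pl-dom m)
trML s (mdia m) = mdia (s pl-rel m)
trML s (mlam m) = mlam (s pl-D m)
trML s (mrep r m) = mrep r (s pl-eq m)

trMR : ∀ {M M' MD MD' y c d} → SubL M M' → SubR MD MD' → MatchR M MD y c d → MatchR M' MD' y c d
trMR s s' (rper p m) = rper p (s' p m)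
trMR s s' rcon = rcon
trMR s s' rand1 = rand1
trMR s s' rand2 = rand2
trMR s s' ror = ror
trMR s s' rimp = rimp
trMR s s' (rall m) = rall (s pl-dom m)
trMR s s' (rbox m) = rbox (s pl-rel m)
trMR s s' (rrep r m) = rrep r (s pl-eq m)

trMLs : ∀ {M M' Γ c d} → SubL M M' → MatchLs M Γ c d → MatchLs M' Γ c d
trMLs s [] = []
trMLs s (m ∷ ms) = trML s m ∷ trMLs s ms

trMRs : ∀ {M M' MD MD' Δ c d} → SubL M M' → SubR MD MD' → MatchRs M MD Δ c d → MatchRs M' MD' Δ c d
trMRs s s' [] = []
trMRs s s' (m ∷ ms) = trMR s s' m ∷ trMRs s s' ms

embTr : ∀ {M M' MD MD' T TD Γ Δ} → SubL M M' → SubR MD MD' → Emb M MD T TD Γ Δ → Emb M' MD' T TD Γ Δ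
embTr s s' (emb ml mr pl pr) = emb (trMLs s ml) (trMRs s s' mr) pl pr

embT : ∀ {M MD T T' TD TD' Γ Δ} → T ↭ T' → TD ↭ TD' → Emb M MD T TD Γ Δ → Emb M MD T' TD' Γ Δ
embT p q (emb ml mr pl pr) = emb ml mr (↭-trans (↭-sym p) pl) (↭-trans (↭-sym q) pr)

nilE : ∀ {M MD T TD} → Emb M MD T TD [] []
nilE = emb [] [] ↭-refl ↭-refl

embGrowL : ∀ {M MD T TD Γ Δ} X → Emb M MD T TD Γ Δ → Emb M MD (X ++ T) TD Γ Δ
embGrowL X (emb {cl1} {cl2} {LL} ml mr pl pr) =
  emb {LL = X ++ LL} ml mr (↭-trans (++⁺ˡ X pl) (↭-trans (↭-reflexive (cong (X ++_) (sym (++-assoc cl1 cl2 LL))))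
      (↭-trans (shifts X (cl1 ++ cl2)) (↭-reflexive (++-assoc cl1 cl2 (X ++ LL)))))) pr

record ExtL (M : List LItem) (MD : List Fm) (T : List LItem) (TD : List Fm) (x : LItem) (Γ : List LItem) (Δ : List Fm) : Set where
  constructor extl
  field
    {c T0} : List LItem
    {d TD0} : List Fm
    m : MatchL M x c d
    e : Emb M MD T0 TD0 Γ Δ
    pT : T ↭ c ++ T0
    pD : TD ↭ d ++ TD0

record ExtR (M : List LItem) (MD : List Fm) (T : List LItem) (TD : List Fm) (Γ : List LItem) (y : Fm) (Δ : List Fm) : Set where
  constructor extr
  field
    {c T0} : List LItem
    {d TD0} : List Fm
    m : MatchR M MD y c d
    e : Emb M MD T0 TD0 Γ Δ
    pT : T ↭ c ++ T0
    pD : TD ↭ d ++ TD0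

extL : ∀ {M MD T TD x Γ Δ} → Emb M MD T TD (x ∷ Γ) Δ → ExtL M MD T TD x Γ Δ
extL (emb {cl2 = cl2} {LL} {cr2 = cr2} {RR} (_∷_ {c = c} {d} {cs = cs} {ds} m ml) mr pl pr) =
  extl m (emb ml mr ↭-refl ↭-refl) (↭-trans pl (↭-reflexive (++-assoc c cs (cl2 ++ LL)))) (↭-trans pr (↭-reflexive (++-assoc d ds (cr2 ++ RR))))

extR : ∀ {M MD T TD Γ y Δ} → Emb M MD T TD Γ (y ∷ Δ) → ExtR M MD T TD Γ y Δ
extR (emb {cl1} {LL = LL} {cr1} {RR = RR} ml (_∷_ {c = c} {d} {cs = cs} {ds} m mr) pl pr) =
  extr m (emb ml mr ↭-refl ↭-refl)
    (↭-trans pl (↭-trans (↭-reflexive (cong (cl1 ++_) (++-assoc c cs LL))) (shifts cl1 c)))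
    (↭-trans pr (↭-trans (↭-reflexive (cong (cr1 ++_) (++-assoc d ds RR))) (shifts cr1 d)))

consL : ∀ {M MD T0 TD0 x c d Γ Δ} → MatchL M x c d → Emb M MD T0 TD0 Γ Δ → Emb M MD (c ++ T0) (d ++ TD0) (x ∷ Γ) Δ
consL {c = c} {d} m (emb {cl1} {cl2} {LL} {cr1} {cr2} {RR} ml mr pl pr) =
  emb (m ∷ ml) mr (↭-trans (++⁺ˡ c pl) (↭-reflexive (sym (++-assoc c cl1 (cl2 ++ LL)))))
                  (↭-trans (++⁺ˡ d pr) (↭-reflexive (sym (++-assoc d cr1 (cr2 ++ RR)))))

consR : ∀ {M MD T0 TD0 y c d Γ Δ} → MatchR M MD y c d → Emb M MD T0 TD0 Γ Δ → Emb M MD (c ++ T0) (d ++ TD0) Γ (y ∷ Δ)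
consR {c = c} {d} m (emb {cl1} {cl2} {LL} {cr1} {cr2} {RR} ml mr pl pr) =
  emb ml (m ∷ mr) (↭-trans (++⁺ˡ c pl) (↭-trans (shifts c cl1) (↭-reflexive (cong (cl1 ++_) (sym (++-assoc c cl2 LL))))))
                  (↭-trans (++⁺ˡ d pr) (↭-trans (shifts d cr1) (↭-reflexive (cong (cr1 ++_) (sym (++-assoc d cr2 RR))))))

embPermL : ∀ {M MD T TD Γ Γ' Δ} → Γ ↭ Γ' → Emb M MD T TD Γ Δ → Emb M MD T TD Γ' Δ
embPermL Perm.refl e = e
embPermL (Perm.prep x p) e with extl m e0 pT pD ← extL e = embT (↭-sym pT) (↭-sym pD) (consL m (embPermL p e0))
embPermL (Perm.swap x y p) e with extl {c1} {_} {d1} m1 e1 pT1 pD1 ← extL e with extl {c2} {_} {d2} m2 e2 pT2 pD2 ← extL e1 =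
  embT (↭-trans (shifts c2 c1) (↭-sym (↭-trans pT1 (++⁺ˡ c1 pT2)))) (↭-trans (shifts d2 d1) (↭-sym (↭-trans pD1 (++⁺ˡ d1 pD2))))
    (consL m2 (consL m1 (embPermL p e2)))
embPermL (Perm.trans p q) e = embPermL q (embPermL p e)

embPermR : ∀ {M MD T TD Γ Δ Δ'} → Δ ↭ Δ' → Emb M MD T TD Γ Δ → Emb M MD T TD Γ Δ'
embPermR Perm.refl e = e
embPermR (Perm.prep x p) e with extr m e0 pT pD ← extR e = embT (↭-sym pT) (↭-sym pD) (consR m (embPermR p e0))
embPermR (Perm.swap x y p) e with extr {c1} {_} {d1} m1 e1 pT1 pD1 ← extR e with extr {c2} {_} {d2} m2 e2 pT2 pD2 ← extR e1 =
  embT (↭-trans (shifts c2 c1) (↭-sym (↭-trans pT1 (++⁺ˡ c1 pT2)))) (↭-trans (shifts d2 d1) (↭-sym (↭-trans pD1 (++⁺ˡ d1 pD2))))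
    (consR m2 (consR m1 (embPermR p e2)))
embPermR (Perm.trans p q) e = embPermR q (embPermR p e)

∈-split : ∀ {A : Set} {x : A} {xs} → x ∈ xs → Σ (List A) λ ys → xs ↭ x ∷ ys
∈-split {x = x} m with ∈-∃++ m
... | ys , zs , refl = ys ++ zs , shift x ys zs

two-split : ∀ {A : Set} {x y : A} {xs} → x ∈ xs → y ∈ xs → (Σ (List A) λ ys → xs ↭ x ∷ y ∷ ys) ⊎ (x ≡ y)
two-split p q with ∈-split p
... | ys , pr with ∈-resp-↭ pr q
...   | here e = inj₂ (sym e)
...   | there q' with ∈-split q'
...     | zs , pr' = inj₁ (zs , ↭-trans pr (↭-prep _ pr'))

subL-refl : ∀ {M} → SubL M M
subL-refl p m = m

subR-refl : ∀ {M} → SubR M M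
subR-refl p m = m

subL-cons : ∀ {M} X → SubL M (X ++ M)
subL-cons X p m = ∈-++⁺ʳ X m

subR-cons : ∀ {M} X → SubR M (X ++ M)
subR-cons X p m = ∈-++⁺ʳ X m

subL-con : ∀ {M M0 x} → ¬ PersL x → M ↭ x ∷ M0 → ∀ X → SubL M (X ++ M0)
subL-con np q X p m with ∈-resp-↭ q m
... | here refl = ⊥-elim (np p)
... | there m' = ∈-++⁺ʳ X m'

subR-con : ∀ {M M0 x} → ¬ PersR x → M ↭ x ∷ M0 → ∀ X → SubR M (X ++ M0)
subR-con np q X p m with ∈-resp-↭ q m
... | here refl = ⊥-elim (np p)
... | there m' = ∈-++⁺ʳ X m'

-- Expressions closed by an initial sequent: labelled atoms and D(y, x, w) with y a
-- variable.  They are exactly the expressions to which the rule Repl applies.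
data AtFm : Fm → Set where
  at-p : ∀ {w p} → IsAtomic p → AtFm (w ∶ p)
  at-D : ∀ {y x w} → AtFm (D (var (fv y)) x w)

atR : ∀ {a b f f'} → FmRep a b f f' → AtFm f → AtFm f'
atR (fmF (fpr P rs)) (at-p _) = at-p (at-pred P _)
atR (fmF (feq r1 r2)) (at-p _) = at-p (at-eq _ _)
atR (fmD (tvar (vsame _)) r2) at-D = at-D
atR (fmD (tvar vab) r2) at-D = at-D

atL : ∀ {a b f f'} → FmRep a b f f' → AtFm f' → AtFm f
atL (fmF (fpr P rs)) (at-p _) = at-p (at-pred P _)
atL (fmF (feq r1 r2)) (at-p _) = at-p (at-eq _ _)
atL (fmD (tvar (vsame _)) r2) at-D = at-D
atL (fmD (tvar vab) r2) at-D = at-D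

labEq : ∀ {a b f f'} → FmRep a b f f' → labFm f ≡ labFm f'
labEq (fmF r) = refl
labEq (fmD r1 r2) = refl

-- To see a replacement f ⇝ f' of an initial expression as an instance of Repl,
-- we write f = E[a/x₀] and f' = E[b/x₀] for a fresh x₀: E marks by x₀ the
-- positions where a is replaced.
mkV0 : ∀ {a b} {u u' : V 0} → VarRep a b u u' → Var → V 0
mkV0 (vsame v) x0 = v
mkV0 vab x0 = fv x0

mkVs : ∀ {a b} {us us' : List (V 0)} → Pointwise (VarRep a b) us us' → Var → List (V 0)
mkVs [] x0 = []
mkVs (r ∷ rs) x0 = mkV0 r x0 ∷ mkVs rs x0

mkVar : ∀ {a b x x'} → VarRep {0} a b (fv x) (fv x') → Var → Var
mkVar {x = x} (vsame _) x0 = x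
mkVar vab x0 = x0

subL-mkV : ∀ {a b} {u u' : V 0} (r : VarRep a b u u') x0 → x0 ∉ varsV u → fsubV a x0 (mkV0 r x0) ≡ u
subL-mkV (vsame (fv c)) x0 n = cong fv (svar-ne λ e → n (here (sym e)))
subL-mkV vab x0 n = cong fv (svar-eq {x = x0})

subR-mkV : ∀ {a b} {u u' : V 0} (r : VarRep a b u u') x0 → x0 ∉ varsV u' → fsubV b x0 (mkV0 r x0) ≡ u'
subR-mkV (vsame (fv c)) x0 n = cong fv (svar-ne λ e → n (here (sym e)))
subR-mkV vab x0 n = cong fv (svar-eq {x = x0})

subL-mkVs : ∀ {a b} {us us' : List (V 0)} (rs : Pointwise (VarRep a b) us us') x0 → x0 ∉ varsVs us → map (fsubV a x0) (mkVs rs x0) ≡ us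
subL-mkVs [] x0 n = refl
subL-mkVs {us = u ∷ us} (r ∷ rs) x0 n = cong₂ _∷_ (subL-mkV r x0 (∉++ˡ n)) (subL-mkVs rs x0 (∉++ʳ (varsV u) n))

subR-mkVs : ∀ {a b} {us us' : List (V 0)} (rs : Pointwise (VarRep a b) us us') x0 → x0 ∉ varsVs us' → map (fsubV b x0) (mkVs rs x0) ≡ us'
subR-mkVs [] x0 n = refl
subR-mkVs {us' = u ∷ us} (r ∷ rs) x0 n = cong₂ _∷_ (subR-mkV r x0 (∉++ˡ n)) (subR-mkVs rs x0 (∉++ʳ (varsV u) n))

subL-mkVar : ∀ {a b x x'} (r : VarRep {0} a b (fv x) (fv x')) x0 → ¬ x0 ≡ x → svar a x0 (mkVar r x0) ≡ x
subL-mkVar (vsame _) x0 n = svar-ne λ e → n (sym e)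
subL-mkVar vab x0 n = svar-eq {x = x0}

subR-mkVar : ∀ {a b x x'} (r : VarRep {0} a b (fv x) (fv x')) x0 → ¬ x0 ≡ x' → svar b x0 (mkVar r x0) ≡ x'
subR-mkVar (vsame _) x0 n = svar-ne λ e → n (sym e)
subR-mkVar vab x0 n = svar-eq {x = x0}

record ReplW (a b : Var) (f f' : Fm) : Set where
  constructor replw
  field
    E : LItem
    x0 : Var
    ri : ReplItem (labFm f) E
    ea : subL a x0 E ≡ F f
    eb : subL b x0 E ≡ F f'

mkRepl : ∀ {a b f f'} → FmRep a b f f' → AtFm f → ReplW a b f f'
mkRepl {a} {b} {w ∶ Pr P us} {w ∶ Pr P us'} (fmF (fpr P rs)) (at-p _) =
  replw (F (w ∶ Pr P (mkVs rs x0))) x0 (r-atom (at-pred P _))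
    (cong (λ z → F (w ∶ Pr P z)) (subL-mkVs rs x0 (∉++ˡ (fresh∉ (varsVs us ++ varsVs us')))))
    (cong (λ z → F (w ∶ Pr P z)) (subR-mkVs rs x0 (∉++ʳ (varsVs us) (fresh∉ (varsVs us ++ varsVs us')))))
  where x0 = fresh (varsVs us ++ varsVs us')
mkRepl {a} {b} {w ∶ Eq u1 u2} {w ∶ Eq u1' u2'} (fmF (feq r1 r2)) (at-p _) =
  replw (F (w ∶ Eq (mkV0 r1 x0) (mkV0 r2 x0))) x0 (r-atom (at-eq _ _))
    (cong₂ (λ p q → F (w ∶ Eq p q)) (subL-mkV r1 x0 (λ m → nx (∈-++⁺ˡ (∈-++⁺ˡ m)))) (subL-mkV r2 x0 (λ m → nx (∈-++⁺ˡ (∈-++⁺ʳ (varsV u1) m)))))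
    (cong₂ (λ p q → F (w ∶ Eq p q)) (subR-mkV r1 x0 (λ m → nx (∈-++⁺ʳ L1 (∈-++⁺ˡ m)))) (subR-mkV r2 x0 (λ m → nx (∈-++⁺ʳ L1 (∈-++⁺ʳ (varsV u1') m)))))
  where
  L1 = varsV u1 ++ varsV u2
  x0 = fresh (L1 ++ (varsV u1' ++ varsV u2'))
  nx = fresh∉ (L1 ++ (varsV u1' ++ varsV u2'))
mkRepl {a} {b} {D (var (fv y)) x w} {D (var u') x' w} (fmD (tvar r1) r2) at-D =
  replw (F (D (var (mkV0 r1 x0)) (mkVar r2 x0) w)) x0 (r-den _ _)
    (cong₂ (λ p q → F (D (var p) q w)) (subL-mkV r1 x0 (λ m → nx1 (∈-++⁺ˡ m))) (subL-mkVar r2 x0 (λ e → nx1 (there (here e)))))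
    (cong₂ (λ p q → F (D (var p) q w)) (subR-mkV r1 x0 (λ m → nx2 (∈-++⁺ˡ m))) (subR-mkVar r2 x0 (λ e → nx2 (∈-++⁺ʳ (varsV u') (here e)))))
  where
  L1 = y ∷ x ∷ []
  L2 = varsV u' ++ x' ∷ []
  x0 = fresh (L1 ++ L2)
  nx = fresh∉ (L1 ++ L2)
  nx1 : x0 ∉ L1
  nx1 = ∉++ˡ nx
  nx2 : x0 ∉ L2
  nx2 = ∉++ʳ L1 nx

data AvailL (T : List LItem) (f : Fm) : Set where
  avE : F f ∈ T → AvailL T f
  avR : ∀ {a b f'} → FmRep a b f' f → F f' ∈ T → EqAt f a b ∈ T → AvailL T f

data AvailR (T : List LItem) (TD : List Fm) (f : Fm) : Set where
  avE : f ∈ TD → AvailR T TD f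
  avR : ∀ {a b f'} → FmRep a b f f' → f' ∈ TD → EqAt f a b ∈ T → AvailR T TD f

avLwk : ∀ {T f} X → AvailL T f → AvailL (X ++ T) f
avLwk X (avE m) = avE (∈-++⁺ʳ X m)
avLwk X (avR r m1 m2) = avR r (∈-++⁺ʳ X m1) (∈-++⁺ʳ X m2)

avRwk : ∀ {T TD f} X → AvailR T TD f → AvailR (X ++ T) TD f
avRwk X (avE m) = avE m
avRwk X (avR r m1 m2) = avR r m1 (∈-++⁺ʳ X m2)

inC : ∀ {A : Set} {T c T0 : List A} {z} → T ↭ c ++ T0 → z ∈ c → z ∈ T
inC p m = ∈-resp-↭ (↭-sym p) (∈-++⁺ˡ m)

inT0 : ∀ {A : Set} {T c T0 : List A} {z} → T ↭ c ++ T0 → z ∈ T0 → z ∈ T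
inT0 {c = c} p m = ∈-resp-↭ (↭-sym p) (∈-++⁺ʳ c m)

persAvF : ∀ {T f c d} → PersL (F f) → MatchL T (F f) c d → (∀ {z} → z ∈ c → z ∈ T) → AvailL T f
persAvF p (mper _ m) h = avE m
persAvF p mcon h = avE (h (here refl))
persAvF p (mrep r m) h = avR r (h (here refl)) m

persAvR : ∀ {T TD f c d} → PersR f → MatchR T TD f c d → (∀ {z} → z ∈ d → z ∈ TD) → AvailR T TD f
persAvR p (rper _ m) h = avE m
persAvR p rcon h = avE (h (here refl))
persAvR p (rrep r m) h = avR r (h (here refl)) m

-- Domain and relational atoms are persistent and never replaced: they occur in the target.
memDom : ∀ {T x w c d} → MatchL T (dom x w) c d → (∀ {z} → z ∈ c → z ∈ T) → dom x w ∈ T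
memDom (mper _ m) h = m
memDom mcon h = h (here refl)

memRel : ∀ {T w v c d} → MatchL T (rel w v) c d → (∀ {z} → z ∈ c → z ∈ T) → rel w v ∈ T
memRel (mper _ m) h = m
memRel mcon h = h (here refl)

updF1 : ∀ s z z' (A : Form 1) → z ∉ varsF A → renF (liftR (fren (upd s z z'))) A ≡ renF (liftR (fren s)) A
updF1 s z z' A nz = extF A (liftExt (updExt s z z' nz))

instEq : ∀ s z z' (A : Form 1) → z ∉ varsF A → renF (fren (upd s z z')) (inst A z) ≡ inst (renF (liftR (fren s)) A) z'
instEq s z z' A nz = trans (renInst (upd s z z') A z) (cong₂ inst (updF1 s z z' A nz) (upd-here s z z'))

renInstσ : ∀ σ w (A : Form 1) y → renFm σ (w ∶ inst A y) ≡ (ls σ w ∶ inst (renF (liftR (fren (vs σ))) A) (vs σ y))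
renInstσ σ w A y = cong (ls σ w ∶_) (renInst (vs σ) A y)

hd≡ : ∀ {A : Set} {x y : A} (xs : List A) → x ≡ y → x ∷ xs ≡ y ∷ xs
hd≡ xs refl = refl

substEmbL : ∀ {M MD T TD Γ Γ' Δ} → Γ ≡ Γ' → Emb M MD T TD Γ' Δ → Emb M MD T TD Γ Δ
substEmbL refl e = e

substEmbR : ∀ {M MD T TD Γ Δ Δ'} → Δ ≡ Δ' → Emb M MD T TD Γ Δ' → Emb M MD T TD Γ Δ
substEmbR refl e = e

substEmb : ∀ {M MD T TD Γ Γ' Δ Δ'} → (Γ ≡ Γ') × (Δ ≡ Δ') → Emb M MD T TD Γ' Δ' → Emb M MD T TD Γ Δ
substEmb (refl , refl) e = e

-- The premise of an eigenvariable rule (R∀, L∃, Lλ, RD), renamed by an update at the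
-- eigenvariable z, is the expected premise of the same rule in the target: since z is
-- fresh for the conclusion, the rest of the premise is unaffected.
premise-R∀ : ∀ σ {w A z Γ Δ} u → FreshVar z Γ ((w ∶ All A) ∷ Δ) →
  (map (renItem (updVar σ z u)) (dom z w ∷ Γ) ≡ dom u (ls σ w) ∷ map (renItem σ) Γ)
  × (map (renFm (updVar σ z u)) ((w ∶ inst A z) ∷ Δ) ≡ (ls σ w ∶ inst (renF (liftR (fren (vs σ))) A) u) ∷ map (renFm σ) Δ)
premise-R∀ σ {w} {A} {z} {Γ} {Δ} u nz =
    cong₂ _∷_ (cong (λ q → dom q (ls σ w)) (upd-here (vs σ) z u)) (updVLs σ z u Γ (∉++ˡ nz))
  , cong₂ _∷_ (cong (ls σ w ∶_) (instEq (vs σ) z u A (∉++ˡ nzA))) (updVFms σ z u Δ (∉++ʳ (varsF A) nzA))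
  where
  nzA = ∉++ʳ (concatMapL varsL Γ) nz

premise-L∃ : ∀ σ {w A z Γ Δ} u → FreshVar z (F (w ∶ Ex A) ∷ Γ) Δ →
  (map (renItem (updVar σ z u)) (dom z w ∷ F (w ∶ inst A z) ∷ Γ)
     ≡ dom u (ls σ w) ∷ F (ls σ w ∶ inst (renF (liftR (fren (vs σ))) A) u) ∷ map (renItem σ) Γ)
  × (map (renFm (updVar σ z u)) Δ ≡ map (renFm σ) Δ)
premise-L∃ σ {w} {A} {z} {Γ} {Δ} u nz =
    cong₂ _∷_ (cong (λ q → dom q (ls σ w)) (upd-here (vs σ) z u))
      (cong₂ _∷_ (cong (λ q → F (ls σ w ∶ q)) (instEq (vs σ) z u A (∉++ˡ (∉++ˡ nz))))
        (updVLs σ z u Γ (∉++ʳ (varsF A) (∉++ˡ nz))))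
  , updVFms σ z u Δ (∉++ʳ (varsF A ++ concatMapL varsL Γ) nz)

premise-Lλ : ∀ σ {w B t z Γ Δ} u → FreshVar z (F (w ∶ Lam B t) ∷ Γ) Δ →
  (map (renItem (updVar σ z u)) (F (D t z w) ∷ F (w ∶ inst B z) ∷ Γ)
     ≡ F (D (renT (fren (vs σ)) t) u (ls σ w)) ∷ F (ls σ w ∶ inst (renF (liftR (fren (vs σ))) B) u) ∷ map (renItem σ) Γ)
  × (map (renFm (updVar σ z u)) Δ ≡ map (renFm σ) Δ)
premise-Lλ σ {w} {B} {t} {z} {Γ} {Δ} u nz =
    cong₂ _∷_ (cong₂ (λ p q → F (D p q (ls σ w))) (updT (vs σ) z u t nzt) (upd-here (vs σ) z u))
      (cong₂ _∷_ (cong (λ q → F (ls σ w ∶ q)) (instEq (vs σ) z u B nzB))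
        (updVLs σ z u Γ (∉++ʳ (varsF B ++ varsT t) (∉++ˡ nz))))
  , updVFms σ z u Δ (∉++ʳ ((varsF B ++ varsT t) ++ concatMapL varsL Γ) nz)
  where
  nzB : z ∉ varsF B
  nzB m = nz (∈-++⁺ˡ (∈-++⁺ˡ (∈-++⁺ˡ m)))
  nzt : z ∉ varsT t
  nzt m = nz (∈-++⁺ˡ (∈-++⁺ˡ (∈-++⁺ʳ (varsF B) m)))

premise-RD : ∀ σ {w A x z Γ Δ} u → FreshVar z Γ (D (iota A) x w ∷ Δ) →
  (map (renItem (updVar σ z u)) (F (w ∶ inst A z) ∷ Γ) ≡ F (ls σ w ∶ inst (renF (liftR (fren (vs σ))) A) u) ∷ map (renItem σ) Γ)
  × (map (renFm (updVar σ z u)) ((w ∶ eqv x z) ∷ Δ) ≡ (ls σ w ∶ eqv (vs σ x) u) ∷ map (renFm σ) Δ)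
premise-RD σ {w} {A} {x} {z} {Γ} {Δ} u nz =
    cong₂ _∷_ (cong (λ q → F (ls σ w ∶ q)) (instEq (vs σ) z u A nzA)) (updVLs σ z u Γ (∉++ˡ nz))
  , cong₂ _∷_ (cong₂ (λ p q → ls σ w ∶ eqv p q) (upd-there (vs σ) z u x nzx) (upd-here (vs σ) z u))
      (updVFms σ z u Δ (∉++ʳ (varsF A ++ x ∷ []) (∉++ʳ cΓ nz)))
  where
  cΓ = concatMapL varsL Γ
  nzA : z ∉ varsF A
  nzA m = nz (∈-++⁺ʳ cΓ (∈-++⁺ˡ (∈-++⁺ˡ m)))
  nzx : ¬ x ≡ z
  nzx e = nz (∈-++⁺ʳ cΓ (∈-++⁺ˡ (∈-++⁺ʳ (varsF A) (here (sym e)))))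

premise-R□ : ∀ σ {w u A Γ Δ} u' → FreshLab u Γ ((w ∶ Box A) ∷ Δ) →
  (map (renItem (updLab σ u u')) (rel w u ∷ Γ) ≡ rel (ls σ w) u' ∷ map (renItem σ) Γ)
  × (map (renFm (updLab σ u u')) ((u ∶ A) ∷ Δ) ≡ (u' ∶ renF (fren (vs σ)) A) ∷ map (renFm σ) Δ)
premise-R□ σ {w} {u} {A} {Γ} {Δ} u' nu =
    cong₂ _∷_ (cong₂ rel (upd-there (ls σ) u u' w (ne-of-∉ nu (∈-++⁺ʳ lΓ (here refl)))) (upd-here (ls σ) u u'))
      (updLLs σ u u' Γ (∉++ˡ nu))
  , cong₂ _∷_ (cong (_∶ renF (fren (vs σ)) A) (upd-here (ls σ) u u')) (updLFms σ u u' Δ (λ m → nu (∈-++⁺ʳ lΓ (there m))))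
  where
  lΓ = concatMapL labsL Γ

premise-L◇ : ∀ σ {w u A Γ Δ} u' → FreshLab u (F (w ∶ Dia A) ∷ Γ) Δ →
  (map (renItem (updLab σ u u')) (rel w u ∷ F (u ∶ A) ∷ Γ) ≡ rel (ls σ w) u' ∷ F (u' ∶ renF (fren (vs σ)) A) ∷ map (renItem σ) Γ)
  × (map (renFm (updLab σ u u')) Δ ≡ map (renFm σ) Δ)
premise-L◇ σ {w} {u} {A} {Γ} {Δ} u' nu =
    cong₂ _∷_ (cong₂ rel (upd-there (ls σ) u u' w (ne-of-∉ nu (here refl))) (upd-here (ls σ) u u'))
      (cong₂ _∷_ (cong (λ q → F (q ∶ renF (fren (vs σ)) A)) (upd-here (ls σ) u u'))
        (updLLs σ u u' Γ (λ m → nu (there (∈-++⁺ˡ m)))))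
  , updLFms σ u u' Δ (∉++ʳ (w ∷ concatMapL labsL Γ) nu)

grow : ∀ {T TD Γ Δ} X → Emb T TD T TD Γ Δ → Emb (X ++ T) TD (X ++ T) TD Γ Δ
grow X e = embGrowL X (embTr (subL-cons X) subR-refl e)

atPers : ∀ {f} → AtFm f → PersL (F f)
atPers (at-p (at-pred P xs)) = pl-pr
atPers (at-p (at-eq x y)) = pl-eq
atPers at-D = pl-D

atPersR : ∀ {f} → AtFm f → PersR f
atPersR (at-p (at-pred P xs)) = pr-pr
atPersR (at-p (at-eq x y)) = pr-eq
atPersR at-D = pr-D

relInj : ∀ {a b c d} → rel a b ≡ rel c d → (a ≡ c) × (b ≡ d)
relInj refl = refl , refl

allL : ∀ {M} Γ → MatchLs M Γ Γ []
allL [] = []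
allL (x ∷ Γ) = mcon ∷ allL Γ

allR : ∀ {M MD} Δ → MatchRs M MD Δ [] Δ
allR [] = []
allR (x ∷ Δ) = rcon ∷ allR Δ

idE : ∀ {M MD} Γ Δ → Emb M MD Γ Δ Γ Δ
idE Γ Δ = emb (allL Γ) (allR Δ) (↭-reflexive (sym (++-identityʳ Γ))) (↭-reflexive (sym (++-identityʳ Δ)))

≤ˡ : ∀ {a b n} → suc (a + b) ≤ suc n → a ≤ n
≤ˡ {a} {b} (s≤s p) = ≤-trans (m≤m+n a b) p

≤ʳ : ∀ {a b n} → suc (a + b) ≤ suc n → b ≤ n
≤ʳ {a} {b} (s≤s p) = ≤-trans (m≤n+m b a) p

swap2 : ∀ {A : Set} {x y : A} {xs} → x ∷ y ∷ xs ↭ y ∷ x ∷ xs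
swap2 = ↭-swap _ _ ↭-refl

rot3 : ∀ {A : Set} {x y z : A} {xs} → x ∷ y ∷ z ∷ xs ↭ y ∷ z ∷ x ∷ xs
rot3 = ↭-trans swap2 (↭-prep _ swap2)

sizeI : ∀ (A : Form 1) y {n} → sizeF A ≤ n → sizeF (inst A y) ≤ n
sizeI A y p = ≤-trans (≤-reflexive (sizeInst A y)) p

module _ (N : List NRule) where

  replStep : ∀ {w E x0 a b R TD P Q} → ReplItem w E → subL a x0 E ≡ P → subL b x0 E ≡ Q →
             N ⊢ Q ∷ P ∷ F (w ∶ eqv a b) ∷ R ⇒ TD → N ⊢ P ∷ F (w ∶ eqv a b) ∷ R ⇒ TD
  replStep ri refl refl d = Repl ri d

  record Mat (T : List LItem) (TD : List Fm) (g : Fm) : Set where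
    constructor mat
    field
      X : List LItem
      mem : F g ∈ X ++ T
      k : N ⊢ X ++ T ⇒ TD → N ⊢ T ⇒ TD

  -- A degenerate case (f is itself
  -- the identity a = b) is handled by Ref=.
  matL : ∀ {T TD a b f f'} → FmRep a b f f' → AtFm f → F f ∈ T → EqAt f a b ∈ T → Mat T TD f'
  matL {T} {TD} {a} {b} {f} {f'} r at m1 m2 with two-split m1 m2
  ... | inj₁ (R , q) with mkRepl r at
  ...   | replw E x0 ri ea eb =
    mat (F f' ∷ []) (here refl)
      λ d → exch (↭-sym q) ↭-refl (replStep ri ea eb (exch (↭-prep _ q) ↭-refl d))
  matL (fmF (feq (vsame _) (vsame _))) at m1 m2 | inj₂ refl = mat [] m1 (λ d → d)
  matL (fmF (feq (vsame _) vab)) at m1 m2 | inj₂ refl = mat [] m1 (λ d → d)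
  matL (fmF (feq vab (vsame _))) at m1 m2 | inj₂ refl = mat (_ ∷ []) (here refl) (λ d → Ref= d)
  matL (fmF (feq vab vab)) at m1 m2 | inj₂ refl = mat (_ ∷ []) (here refl) (λ d → Ref= d)

  matThen : ∀ {T TD g} → Mat T TD g → (∀ X → F g ∈ X ++ T → N ⊢ X ++ T ⇒ TD) → N ⊢ T ⇒ TD
  matThen (mat X mem k) c = k (c X mem)

  initFromMem : ∀ {T TD f} → AtFm f → F f ∈ T → f ∈ TD → N ⊢ T ⇒ TD
  initFromMem (at-p at) m1 m2 with ∈-split m1 | ∈-split m2
  ... | R , q1 | R' , q2 = exch (↭-sym q1) (↭-sym q2) (initAt at)
  initFromMem at-D m1 m2 with ∈-split m1 | ∈-split m2
  ... | R , q1 | R' , q2 = exch (↭-sym q1) (↭-sym q2) initD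

  exactL : ∀ {T TD f} → AtFm f → AvailL T f → (∀ X → F f ∈ X ++ T → N ⊢ X ++ T ⇒ TD) → N ⊢ T ⇒ TD
  exactL at (avE m) c = c [] m
  exactL {T} at (avR {a} {b} r m1 m2) c = matThen (matL r (atL r at) m1 (subst (λ l → F (l ∶ eqv a b) ∈ T) (sym (labEq r)) m2)) c

  closeAt : ∀ {T TD f} → AtFm f → AvailL T f → AvailR T TD f → N ⊢ T ⇒ TD
  closeAt at avl avr = exactL at avl λ X m → go at X m (avRwk X avr)
    where
    go : ∀ {T TD f} → AtFm f → ∀ X → F f ∈ X ++ T → AvailR (X ++ T) TD f → N ⊢ X ++ T ⇒ TD
    go at X m (avE m') = initFromMem at m m'
    go at X m (avR r m1 m2) = matThen (matL r at m m2) λ Y m3 → initFromMem (atR r at) m3 m1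

  rig : ∀ {T TD w v a b} → F (w ∶ eqv a b) ∈ T → N ⊢ F (v ∶ eqv a b) ∷ T ⇒ TD → N ⊢ T ⇒ TD
  rig m d with ∈-split m
  ... | R , q = exch (↭-sym q) ↭-refl (RigVar (exch (↭-prep _ q) ↭-refl d))

  -- Symmetry of identity: a = b in T allows adding b = a (Ref= then Repl).
  withSym : ∀ {T TD w a b} → F (w ∶ eqv a b) ∈ T → (∀ X → F (w ∶ eqv b a) ∈ X ++ T → N ⊢ X ++ T ⇒ TD) → N ⊢ T ⇒ TD
  withSym {T} {TD} {w} {a} {b} m c =
    Ref= {w = w} {x = a}
      (matThen (matL {f = w ∶ eqv a a} {f' = w ∶ eqv b a} (fmF (feq vab (vsame _))) (at-p (at-eq _ _)) (here refl) (there m))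
        λ X m' → subst (λ L → N ⊢ L ⇒ TD) (++-assoc X (F (w ∶ eqv a a) ∷ []) T) (c (X ++ F (w ∶ eqv a a) ∷ []) (subst (F (w ∶ eqv b a) ∈_) (sym (++-assoc X (F (w ∶ eqv a a) ∷ []) T)) m')))

  Transfers : List LItem → List Fm → Set
  Transfers Γ Δ = ∀ σ {T TD} → Emb T TD T TD (map (renItem σ) Γ) (map (renFm σ) Δ) → N ⊢ T ⇒ TD

  -- If the principal formula is copied, apply the same rule
  -- in the target; if it was inverted, the premise embeds directly; if it was
  -- replaced, apply the rule to the replaced formula and replace its components.
  case-L∧ : ∀ {w A B Γ Δ} → Transfers (F (w ∶ A) ∷ F (w ∶ B) ∷ Γ) Δ → Transfers (F (w ∶ And A B) ∷ Γ) Δ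
  case-L∧ ih σ e with extL e
  ... | extl (mper () _) e0 pT pD
  ... | extl mcon e0 pT pD =
    exch (↭-sym pT) ↭-refl (L∧ (ih σ (embT ↭-refl (↭-sym pD) (consL mcon (consL mcon (embTr (subL-con (λ ()) pT (F _ ∷ F _ ∷ [])) subR-refl e0))))))
  ... | extl mand e0 pT pD = ih σ (embT (↭-sym pT) (↭-sym pD) (consL mcon (consL mcon e0)))
  ... | extl (mrep (fmF (fand r1 r2)) m) e0 pT pD =
    exch (↭-sym pT) ↭-refl (L∧ (ih σ (embT ↭-refl (↭-sym pD) (consL (mrep (fmF r1) (s pl-eq m)) (consL (mrep (fmF r2) (s pl-eq m)) (embTr s subR-refl e0))))))
    where s = subL-con (λ ()) pT (F _ ∷ F _ ∷ [])

  case-L∨ : ∀ {w A B Γ Δ} → Transfers (F (w ∶ A) ∷ Γ) Δ → Transfers (F (w ∶ B) ∷ Γ) Δ → Transfers (F (w ∶ Or A B) ∷ Γ) Δ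
  case-L∨ ih1 ih2 σ e with extL e
  ... | extl (mper () _) e0 pT pD
  ... | extl mcon e0 pT pD =
    exch (↭-sym pT) ↭-refl (L∨ (ih1 σ (embT ↭-refl (↭-sym pD) (consL mcon (embTr (subL-con (λ ()) pT (F _ ∷ [])) subR-refl e0))))
                               (ih2 σ (embT ↭-refl (↭-sym pD) (consL mcon (embTr (subL-con (λ ()) pT (F _ ∷ [])) subR-refl e0)))))
  ... | extl mor1 e0 pT pD = ih1 σ (embT (↭-sym pT) (↭-sym pD) (consL mcon e0))
  ... | extl mor2 e0 pT pD = ih2 σ (embT (↭-sym pT) (↭-sym pD) (consL mcon e0))
  ... | extl (mrep (fmF (for r1 r2)) m) e0 pT pD =
    exch (↭-sym pT) ↭-refl (L∨ (ih1 σ (embT ↭-refl (↭-sym pD) (consL (mrep (fmF r1) (s1 pl-eq m)) (embTr s1 subR-refl e0))))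
                               (ih2 σ (embT ↭-refl (↭-sym pD) (consL (mrep (fmF r2) (s2 pl-eq m)) (embTr s2 subR-refl e0)))))
    where
    s1 = subL-con (λ ()) pT (F _ ∷ [])
    s2 = subL-con (λ ()) pT (F _ ∷ [])

  case-L⊃ : ∀ {w A B Γ Δ} → Transfers Γ ((w ∶ A) ∷ Δ) → Transfers (F (w ∶ B) ∷ Γ) Δ → Transfers (F (w ∶ Imp A B) ∷ Γ) Δ
  case-L⊃ ih1 ih2 σ e with extL e
  ... | extl (mper () _) e0 pT pD
  ... | extl mcon e0 pT pD =
    exch (↭-sym pT) ↭-refl (L⊃ (ih1 σ (embT ↭-refl (↭-prep _ (↭-sym pD)) (consR rcon (embTr (subL-con (λ ()) pT []) (subR-cons (_ ∷ [])) e0))))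
                               (ih2 σ (embT ↭-refl (↭-sym pD) (consL mcon (embTr (subL-con (λ ()) pT (F _ ∷ [])) subR-refl e0)))))
  ... | extl mimp1 e0 pT pD = ih1 σ (embT (↭-sym pT) (↭-sym pD) (consR rcon e0))
  ... | extl mimp2 e0 pT pD = ih2 σ (embT (↭-sym pT) (↭-sym pD) (consL mcon e0))
  ... | extl {T0 = T0} (mrep {a} {b} (fmF (fimp r1 r2)) m) e0 pT pD =
    exch (↭-sym pT) ↭-refl (L⊃
      (withSym (s pl-eq m) λ X m' →
         ih1 σ (embT ↭-refl (↭-prep _ (↭-sym pD)) (consR (rrep (fmF (flipF r1)) m') (embGrowL X (embTr (λ p z → ∈-++⁺ʳ X (s p z)) (subR-cons (_ ∷ [])) e0)))))
      (ih2 σ (embT ↭-refl (↭-sym pD) (consL (mrep (fmF r2) (s2 pl-eq m)) (embTr s2 subR-refl e0)))))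
    where
    s = subL-con (λ ()) pT []
    s2 = subL-con (λ ()) pT (F _ ∷ [])

  case-R∧ : ∀ {w A B Γ Δ} → Transfers Γ ((w ∶ A) ∷ Δ) → Transfers Γ ((w ∶ B) ∷ Δ) → Transfers Γ ((w ∶ And A B) ∷ Δ)
  case-R∧ ih1 ih2 σ e with extR e
  ... | extr (rper () _) e0 pT pD
  ... | extr rcon e0 pT pD =
    exch ↭-refl (↭-sym pD) (R∧ (ih1 σ (embT (↭-sym pT) ↭-refl (consR rcon (embTr subL-refl (subR-con (λ ()) pD (_ ∷ [])) e0))))
                               (ih2 σ (embT (↭-sym pT) ↭-refl (consR rcon (embTr subL-refl (subR-con (λ ()) pD (_ ∷ [])) e0)))))
  ... | extr rand1 e0 pT pD = ih1 σ (embT (↭-sym pT) (↭-sym pD) (consR rcon e0))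
  ... | extr rand2 e0 pT pD = ih2 σ (embT (↭-sym pT) (↭-sym pD) (consR rcon e0))
  ... | extr (rrep (fmF (fand r1 r2)) m) e0 pT pD =
    exch ↭-refl (↭-sym pD) (R∧ (ih1 σ (embT (↭-sym pT) ↭-refl (consR (rrep (fmF r1) m) (embTr subL-refl (subR-con (λ ()) pD (_ ∷ [])) e0))))
                               (ih2 σ (embT (↭-sym pT) ↭-refl (consR (rrep (fmF r2) m) (embTr subL-refl (subR-con (λ ()) pD (_ ∷ [])) e0)))))

  case-R∨ : ∀ {w A B Γ Δ} → Transfers Γ ((w ∶ A) ∷ (w ∶ B) ∷ Δ) → Transfers Γ ((w ∶ Or A B) ∷ Δ)
  case-R∨ ih σ e with extR e
  ... | extr (rper () _) e0 pT pD
  ... | extr rcon e0 pT pD =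
    exch ↭-refl (↭-sym pD) (R∨ (ih σ (embT (↭-sym pT) ↭-refl (consR rcon (consR rcon (embTr subL-refl (subR-con (λ ()) pD (_ ∷ _ ∷ [])) e0))))))
  ... | extr ror e0 pT pD = ih σ (embT (↭-sym pT) (↭-sym pD) (consR rcon (consR rcon e0)))
  ... | extr (rrep (fmF (for r1 r2)) m) e0 pT pD =
    exch ↭-refl (↭-sym pD) (R∨ (ih σ (embT (↭-sym pT) ↭-refl (consR (rrep (fmF r1) m) (consR (rrep (fmF r2) m) (embTr subL-refl s e0))))))
    where s = subR-con (λ ()) pD (_ ∷ _ ∷ [])

  case-R⊃ : ∀ {w A B Γ Δ} → Transfers (F (w ∶ A) ∷ Γ) ((w ∶ B) ∷ Δ) → Transfers Γ ((w ∶ Imp A B) ∷ Δ)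
  case-R⊃ ih σ e with extR e
  ... | extr (rper () _) e0 pT pD
  ... | extr rcon e0 pT pD =
    exch ↭-refl (↭-sym pD) (R⊃ (ih σ (embT (↭-prep _ (↭-sym pT)) ↭-refl (consL mcon (consR rcon (embTr (subL-cons (_ ∷ [])) (subR-con (λ ()) pD (_ ∷ [])) e0))))))
  ... | extr rimp e0 pT pD = ih σ (embT (↭-sym pT) (↭-sym pD) (consL mcon (consR rcon e0)))
  ... | extr (rrep (fmF (fimp r1 r2)) m) e0 pT pD =
    exch ↭-refl (↭-sym pD) (R⊃ (withSym (there m) λ X m' →
       ih σ (embT (↭-trans (shifts (_ ∷ []) X) (++⁺ˡ X (↭-prep _ (↭-sym pT)))) ↭-refl
         (consL (mrep (fmF (flipF r1)) m') (embGrowL X (consR (rrep (fmF r2) (∈-++⁺ʳ X (there m)))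
            (embTr (λ p z → ∈-++⁺ʳ X (there z)) (subR-con (λ ()) pD (_ ∷ [])) e0)))))))

  applyL∀ : ∀ {T TD w A y} → dom y w ∈ T → F (w ∶ All A) ∈ T → N ⊢ F (w ∶ inst A y) ∷ T ⇒ TD → N ⊢ T ⇒ TD
  applyL∀ m1 m2 d with two-split m1 m2
  ... | inj₁ (R , q) = exch (↭-sym q) ↭-refl (L∀ (exch (↭-prep _ q) ↭-refl d))
  ... | inj₂ ()

  applyR∃ : ∀ {T TD w A y} → dom y w ∈ T → (w ∶ Ex A) ∈ TD → N ⊢ T ⇒ (w ∶ inst A y) ∷ TD → N ⊢ T ⇒ TD
  applyR∃ m1 m2 d with ∈-split m1 | ∈-split m2
  ... | R , q | R' , q' = exch (↭-sym q) (↭-sym q') (R∃ (exch q (↭-trans (↭-prep _ q') swap2) d))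

  -- Quantifier rules.  The eigenvariable of R∀ and L∃ is renamed to a name fresh
  -- for the target, or to the witness recorded by an inverted matching (rall, mex).
  case-L∀ : ∀ {w A y Γ Δ} → Transfers (F (w ∶ inst A y) ∷ dom y w ∷ F (w ∶ All A) ∷ Γ) Δ → Transfers (dom y w ∷ F (w ∶ All A) ∷ Γ) Δ
  case-L∀ {w} {A} {y} {Γ} ih σ {T} e with extL e
  ... | extl m1 e1 pT1 pD1 with extL e1
  ...   | extl m2 e2 pT2 pD2 with persAvF pl-all m2 (λ z → inT0 pT1 (inC pT2 z))
  ...     | avE mA = applyL∀ (memDom m1 (inC pT1)) mA
              (ih σ (substEmbL (hd≡ _ (cong F (renInstσ σ w A y))) (consL mcon (embTr (subL-cons (_ ∷ [])) subR-refl e))))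
  ...     | avR (fmF (fall r)) mA mE = applyL∀ (memDom m1 (inC pT1)) mA
              (ih σ (substEmbL (hd≡ _ (cong F (renInstσ σ w A y)))
                 (consL (mrep (fmF (instFR (vsame _) r)) (there mE)) (embTr (subL-cons (_ ∷ [])) subR-refl e))))

  case-R∃ : ∀ {w A y Γ Δ} → Transfers (dom y w ∷ Γ) ((w ∶ Ex A) ∷ (w ∶ inst A y) ∷ Δ) → Transfers (dom y w ∷ Γ) ((w ∶ Ex A) ∷ Δ)
  case-R∃ {w} {A} {y} {Γ} {Δ} ih σ {T} e with extL e | extR e
  ... | extl m1 e1 pT1 pD1 | extr m2 e2 pT2 pD2 with persAvR pr-ex m2 (inC pD2)
  ...   | avE mA = applyR∃ (memDom m1 (inC pT1)) mA
            (ih σ (substEmbR (cong (λ q → (ls σ w ∶ Ex (renF (liftR (fren (vs σ))) A)) ∷ q ∷ map (renFm σ) Δ) (renInstσ σ w A y))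
               (embPermR swap2 (consR rcon (embTr subL-refl (subR-cons (_ ∷ [])) e)))))
  ...   | avR (fmF (fex r)) mA mE = applyR∃ (memDom m1 (inC pT1)) mA
            (ih σ (substEmbR (cong (λ q → (ls σ w ∶ Ex (renF (liftR (fren (vs σ))) A)) ∷ q ∷ map (renFm σ) Δ) (renInstσ σ w A y))
               (embPermR swap2 (consR (rrep (fmF (instFR (vsame _) r)) mE) (embTr subL-refl (subR-cons (_ ∷ [])) e)))))

  case-R∀ : ∀ {w A z Γ Δ} → FreshVar z Γ ((w ∶ All A) ∷ Δ) → Transfers (dom z w ∷ Γ) ((w ∶ inst A z) ∷ Δ) → Transfers Γ ((w ∶ All A) ∷ Δ)
  case-R∀ {w} {A} {z} {Γ} {Δ} nz ih σ {T} {TD} e with extR e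
  ... | extr (rper () _) e0 pT pD
  ... | extr {TD0 = TD0} rcon e0 pT pD =
    exch ↭-refl (↭-sym pD) (R∀ (fresh∉ (varsSeq T ((ls σ w ∶ All rA) ∷ TD0)))
      (ih (updVar σ z z') (substEmb (premise-R∀ σ z' nz)
        (embT (↭-prep _ (↭-sym pT)) ↭-refl (consL mcon (consR rcon (embTr (subL-cons (_ ∷ [])) (subR-con (λ ()) pD (_ ∷ [])) e0)))))))
    where
    rA = renF (liftR (fren (vs σ))) A
    z' = fresh (varsSeq T ((ls σ w ∶ All rA) ∷ TD0))
  ... | extr (rall {u = u} m) e0 pT pD =
    ih (updVar σ z u) (substEmb (premise-R∀ σ u nz) (embT (↭-sym pT) (↭-sym pD) (consL (mper pl-dom m) (consR rcon e0))))
  ... | extr {TD0 = TD0} (rrep {f' = ._ ∶ All A*} (fmF (fall r)) m) e0 pT pD =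
    exch ↭-refl (↭-sym pD) (R∀ (fresh∉ (varsSeq T ((ls σ w ∶ All A*) ∷ TD0)))
      (ih (updVar σ z z') (substEmb (premise-R∀ σ z' nz)
        (embT (↭-prep _ (↭-sym pT)) ↭-refl (consL mcon (consR (rrep (fmF (instFR (vsame _) r)) (there m)) (embTr (subL-cons (_ ∷ [])) (subR-con (λ ()) pD (_ ∷ [])) e0)))))))
    where
    z' = fresh (varsSeq T ((ls σ w ∶ All A*) ∷ TD0))

  case-L∃ : ∀ {w A z Γ Δ} → FreshVar z (F (w ∶ Ex A) ∷ Γ) Δ → Transfers (dom z w ∷ F (w ∶ inst A z) ∷ Γ) Δ → Transfers (F (w ∶ Ex A) ∷ Γ) Δ
  case-L∃ {w} {A} {z} {Γ} {Δ} nz ih σ {T} {TD} e with extL e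
  ... | extl (mper () _) e0 pT pD
  ... | extl {T0 = T0} mcon e0 pT pD =
    exch (↭-sym pT) ↭-refl (L∃ (fresh∉ (varsSeq (F (ls σ w ∶ Ex rA) ∷ T0) TD))
      (ih (updVar σ z z') (substEmb (premise-L∃ σ z' nz)
         (embT ↭-refl (↭-sym pD) (consL mcon (consL mcon (embTr (subL-con (λ ()) pT (_ ∷ _ ∷ [])) subR-refl e0)))))))
    where
    rA = renF (liftR (fren (vs σ))) A
    z' = fresh (varsSeq (F (ls σ w ∶ Ex rA) ∷ T0) TD)
  ... | extl (mex {u = u} m) e0 pT pD =
    ih (updVar σ z u) (substEmb (premise-L∃ σ u nz) (embT (↭-sym pT) (↭-sym pD) (consL (mper pl-dom m) (consL mcon e0))))
  ... | extl {T0 = T0} (mrep {f' = ._ ∶ Ex A*} (fmF (fex r)) m) e0 pT pD =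
    exch (↭-sym pT) ↭-refl (L∃ (fresh∉ (varsSeq (F (ls σ w ∶ Ex A*) ∷ T0) TD))
      (ih (updVar σ z z') (substEmb (premise-L∃ σ z' nz)
         (embT ↭-refl (↭-sym pD) (consL mcon (consL (mrep (fmF (instFR (vsame _) r)) (s pl-eq m)) (embTr s subR-refl e0)))))))
    where
    z' = fresh (varsSeq (F (ls σ w ∶ Ex A*) ∷ T0) TD)
    s = subL-con (λ ()) pT (dom z' (ls σ w) ∷ F (ls σ w ∶ inst A* z') ∷ [])

  applyL□ : ∀ {T TD w v A} → rel w v ∈ T → F (w ∶ Box A) ∈ T → N ⊢ F (v ∶ A) ∷ T ⇒ TD → N ⊢ T ⇒ TD
  applyL□ m1 m2 d with two-split m1 m2
  ... | inj₁ (R , q) = exch (↭-sym q) ↭-refl (L□ (exch (↭-prep _ q) ↭-refl d))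
  ... | inj₂ ()

  applyR◇ : ∀ {T TD w v A} → rel w v ∈ T → (w ∶ Dia A) ∈ TD → N ⊢ T ⇒ (v ∶ A) ∷ TD → N ⊢ T ⇒ TD
  applyR◇ m1 m2 d with ∈-split m1 | ∈-split m2
  ... | R , q | R' , q' = exch (↭-sym q) (↭-sym q') (R◇ (exch q (↭-trans (↭-prep _ q') swap2) d))

  -- Modal rules.  A replaced □A or ◇A at w needs the identity at the accessible
  -- world as well; RigVar provides it.  The eigenlabel of R□ and L◇ is renamed as
  -- for the eigenvariable rules.
  case-L□ : ∀ {w v A Γ Δ} → Transfers (F (v ∶ A) ∷ rel w v ∷ F (w ∶ Box A) ∷ Γ) Δ → Transfers (rel w v ∷ F (w ∶ Box A) ∷ Γ) Δ
  case-L□ ih σ {T} e with extL e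
  ... | extl m1 e1 pT1 pD1 with extL e1
  ...   | extl m2 e2 pT2 pD2 with persAvF pl-box m2 (λ z → inT0 pT1 (inC pT2 z))
  ...     | avE mA = applyL□ (memRel m1 (inC pT1)) mA (ih σ (consL mcon (embTr (subL-cons (_ ∷ [])) subR-refl e)))
  ...     | avR (fmF (fbox r)) mA mE =
    rig mE (applyL□ (there (memRel m1 (inC pT1))) (there mA)
      (ih σ (consL (mrep (fmF r) (there (here refl))) (embTr (subL-cons (_ ∷ _ ∷ [])) subR-refl (embGrowL (_ ∷ []) e)))))

  case-R◇ : ∀ {w v A Γ Δ} → Transfers (rel w v ∷ Γ) ((w ∶ Dia A) ∷ (v ∶ A) ∷ Δ) → Transfers (rel w v ∷ Γ) ((w ∶ Dia A) ∷ Δ)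
  case-R◇ ih σ {T} e with extL e | extR e
  ... | extl m1 e1 pT1 pD1 | extr m2 e2 pT2 pD2 with persAvR pr-dia m2 (inC pD2)
  ...   | avE mA = applyR◇ (memRel m1 (inC pT1)) mA
            (ih σ (embPermR swap2 (consR rcon (embTr subL-refl (subR-cons (_ ∷ [])) e))))
  ...   | avR (fmF (fdia r)) mA mE =
    rig mE (applyR◇ (there (memRel m1 (inC pT1))) mA
      (ih σ (embPermR swap2 (consR (rrep (fmF r) (here refl)) (embTr (subL-cons (_ ∷ [])) (subR-cons (_ ∷ [])) (embGrowL (_ ∷ []) e))))))

  case-R□ : ∀ {w u A Γ Δ} → FreshLab u Γ ((w ∶ Box A) ∷ Δ) → Transfers (rel w u ∷ Γ) ((u ∶ A) ∷ Δ) → Transfers Γ ((w ∶ Box A) ∷ Δ)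
  case-R□ {w} {u} {A} {Γ} {Δ} nu ih σ {T} {TD} e with extR e
  ... | extr (rper () _) e0 pT pD
  ... | extr {TD0 = TD0} rcon e0 pT pD =
    exch ↭-refl (↭-sym pD) (R□ (fresh∉ (labsSeq T ((ls σ w ∶ Box rA) ∷ TD0)))
      (ih (updLab σ u u') (substEmb (premise-R□ σ u' nu)
        (embT (↭-prep _ (↭-sym pT)) ↭-refl (consL mcon (consR rcon (embTr (subL-cons (_ ∷ [])) (subR-con (λ ()) pD (_ ∷ [])) e0)))))))
    where
    rA = renF (fren (vs σ)) A
    u' = fresh (labsSeq T ((ls σ w ∶ Box rA) ∷ TD0))
  ... | extr (rbox {u = v} m) e0 pT pD =
    ih (updLab σ u v) (substEmb (premise-R□ σ v nu) (embT (↭-sym pT) (↭-sym pD) (consL (mper pl-rel m) (consR rcon e0))))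
  ... | extr {TD0 = TD0} (rrep {f' = ._ ∶ Box A*} (fmF (fbox r)) m) e0 pT pD =
    exch ↭-refl (↭-sym pD) (R□ (fresh∉ (labsSeq T ((ls σ w ∶ Box A*) ∷ TD0)))
      (rig (there m) (ih (updLab σ u u') (substEmb (premise-R□ σ u' nu)
        (embT (↭-prep _ (↭-prep _ (↭-sym pT))) ↭-refl (embGrowL (_ ∷ []) (consL mcon (consR (rrep (fmF r) (here refl))
          (embTr (subL-cons (_ ∷ _ ∷ [])) (subR-con (λ ()) pD (_ ∷ [])) e0)))))))))
    where
    u' = fresh (labsSeq T ((ls σ w ∶ Box A*) ∷ TD0))

  case-L◇ : ∀ {w u A Γ Δ} → FreshLab u (F (w ∶ Dia A) ∷ Γ) Δ → Transfers (rel w u ∷ F (u ∶ A) ∷ Γ) Δ → Transfers (F (w ∶ Dia A) ∷ Γ) Δ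
  case-L◇ {w} {u} {A} {Γ} {Δ} nu ih σ {T} {TD} e with extL e
  ... | extl (mper () _) e0 pT pD
  ... | extl {T0 = T0} mcon e0 pT pD =
    exch (↭-sym pT) ↭-refl (L◇ (fresh∉ (labsSeq (F (ls σ w ∶ Dia rA) ∷ T0) TD))
      (ih (updLab σ u u') (substEmb (premise-L◇ σ u' nu)
         (embT ↭-refl (↭-sym pD) (consL mcon (consL mcon (embTr (subL-con (λ ()) pT (_ ∷ _ ∷ [])) subR-refl e0)))))))
    where
    rA = renF (fren (vs σ)) A
    u' = fresh (labsSeq (F (ls σ w ∶ Dia rA) ∷ T0) TD)
  ... | extl (mdia {u = v} m) e0 pT pD =
    ih (updLab σ u v) (substEmb (premise-L◇ σ v nu) (embT (↭-sym pT) (↭-sym pD) (consL (mper pl-rel m) (consL mcon e0))))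
  ... | extl {T0 = T0} (mrep {a} {b} {f' = ._ ∶ Dia A*} (fmF (fdia r)) m) e0 pT pD =
    exch (↭-sym pT) ↭-refl (L◇ (fresh∉ (labsSeq (F (ls σ w ∶ Dia A*) ∷ T0) TD))
      (rig (there (there (s0 pl-eq m))) (ih (updLab σ u u') (substEmb (premise-L◇ σ u' nu)
         (embT ↭-refl (↭-sym pD) (embGrowL (_ ∷ []) (consL mcon (consL (mrep (fmF r) (here refl)) (embTr s subR-refl e0)))))))))
    where
    u' = fresh (labsSeq (F (ls σ w ∶ Dia A*) ∷ T0) TD)
    s0 = subL-con (λ ()) pT []
    s = subL-con (λ ()) pT (F (u' ∶ eqv a b) ∷ rel (ls σ w) u' ∷ F (u' ∶ A*) ∷ [])

  applyRλ : ∀ {T TD w B t y} → (w ∶ Lam B t) ∈ TD → N ⊢ T ⇒ D t y w ∷ TD → N ⊢ T ⇒ (w ∶ inst B y) ∷ TD → N ⊢ T ⇒ TD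
  applyRλ m d1 d2 with ∈-split m
  ... | R , q = exch ↭-refl (↭-sym q) (Rλ (exch ↭-refl (↭-trans (↭-prep _ q) swap2) d1)
                                          (exch ↭-refl (↭-trans (↭-prep _ q) swap2) d2))

  applyLD₁ : ∀ {T TD w A x} → F (D (iota A) x w) ∈ T → N ⊢ F (w ∶ inst A x) ∷ T ⇒ TD → N ⊢ T ⇒ TD
  applyLD₁ m d with ∈-split m
  ... | R , q = exch (↭-sym q) ↭-refl (LD₁ (exch (↭-prep _ q) ↭-refl d))

  applyLD₂ : ∀ {T TD w A x y} → F (D (iota A) x w) ∈ T → N ⊢ T ⇒ (w ∶ inst A y) ∷ TD → N ⊢ F (w ∶ eqv x y) ∷ T ⇒ TD → N ⊢ T ⇒ TD
  applyLD₂ m d1 d2 with ∈-split m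
  ... | R , q = exch (↭-sym q) ↭-refl (LD₂ (exch q ↭-refl d1) (exch (↭-prep _ q) ↭-refl d2))

  applyDenId : ∀ {T TD w x y} → F (D (var (fv y)) x w) ∈ T → N ⊢ F (w ∶ eqv y x) ∷ T ⇒ TD → N ⊢ T ⇒ TD
  applyDenId m d with ∈-split m
  ... | R , q = exch (↭-sym q) ↭-refl (DenId (exch (↭-prep _ q) ↭-refl d))

  -- λ-abstraction and definite descriptions.  A replaced λxB.t splits into replaced
  -- D(t, z, w) and B[z/x]; a replaced D(ιxA, x, w) into replaced instances of A.
  case-Lλ : ∀ {w B t z Γ Δ} → FreshVar z (F (w ∶ Lam B t) ∷ Γ) Δ → Transfers (F (D t z w) ∷ F (w ∶ inst B z) ∷ Γ) Δ → Transfers (F (w ∶ Lam B t) ∷ Γ) Δ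
  case-Lλ {w} {B} {t} {z} {Γ} {Δ} nz ih σ {T} {TD} e with extL e
  ... | extl (mper () _) e0 pT pD
  ... | extl {T0 = T0} mcon e0 pT pD =
    exch (↭-sym pT) ↭-refl (Lλ (fresh∉ (varsSeq (F (ls σ w ∶ Lam rB rt) ∷ T0) TD))
      (ih (updVar σ z z') (substEmb (premise-Lλ σ z' nz)
         (embT ↭-refl (↭-sym pD) (consL mcon (consL mcon (embTr (subL-con (λ ()) pT (_ ∷ _ ∷ [])) subR-refl e0)))))))
    where
    rB = renF (liftR (fren (vs σ))) B
    rt = renT (fren (vs σ)) t
    z' = fresh (varsSeq (F (ls σ w ∶ Lam rB rt) ∷ T0) TD)
  ... | extl (mlam {u = u} m) e0 pT pD =
    ih (updVar σ z u) (substEmb (premise-Lλ σ u nz) (embT (↭-sym pT) (↭-sym pD) (consL (mper pl-D m) (consL mcon e0))))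
  ... | extl {T0 = T0} (mrep {f' = ._ ∶ Lam B* t*} (fmF (flam r1 r2)) m) e0 pT pD =
    exch (↭-sym pT) ↭-refl (Lλ (fresh∉ (varsSeq (F (ls σ w ∶ Lam B* t*) ∷ T0) TD))
      (ih (updVar σ z z') (substEmb (premise-Lλ σ z' nz)
         (embT ↭-refl (↭-sym pD) (consL (mrep (fmD r2 (vsame _)) (s pl-eq m)) (consL (mrep (fmF (instFR (vsame _) r1)) (s pl-eq m)) (embTr s subR-refl e0)))))))
    where
    z' = fresh (varsSeq (F (ls σ w ∶ Lam B* t*) ∷ T0) TD)
    s = subL-con (λ ()) pT (F (D t* z' (ls σ w)) ∷ F (ls σ w ∶ inst B* z') ∷ [])

  case-Rλ : ∀ {w B t y Γ Δ} → Transfers Γ ((w ∶ Lam B t) ∷ D t y w ∷ Δ) → Transfers Γ ((w ∶ Lam B t) ∷ (w ∶ inst B y) ∷ Δ) → Transfers Γ ((w ∶ Lam B t) ∷ Δ)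
  case-Rλ {w} {B} {t} {y} {Γ} {Δ} ih1 ih2 σ {T} e with extR e
  ... | extr m e0 pT pD with persAvR pr-lam m (inC pD)
  ...   | avE mL = applyRλ mL
            (ih1 σ (embPermR swap2 (consR rcon (embTr subL-refl (subR-cons (_ ∷ [])) e))))
            (ih2 σ (substEmbR (cong (λ q → (ls σ w ∶ Lam (renF (liftR (fren (vs σ))) B) (renT (fren (vs σ)) t)) ∷ q ∷ map (renFm σ) Δ) (renInstσ σ w B y))
               (embPermR swap2 (consR rcon (embTr subL-refl (subR-cons (_ ∷ [])) e)))))
  ...   | avR (fmF (flam r1 r2)) mL mE = applyRλ mL
            (ih1 σ (embPermR swap2 (consR (rrep (fmD r2 (vsame _)) mE) (embTr subL-refl (subR-cons (_ ∷ [])) e))))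
            (ih2 σ (substEmbR (cong (λ q → (ls σ w ∶ Lam (renF (liftR (fren (vs σ))) B) (renT (fren (vs σ)) t)) ∷ q ∷ map (renFm σ) Δ) (renInstσ σ w B y))
               (embPermR swap2 (consR (rrep (fmF (instFR (vsame _) r1)) mE) (embTr subL-refl (subR-cons (_ ∷ [])) e)))))

  case-LD₁ : ∀ {w A x Γ Δ} → Transfers (F (w ∶ inst A x) ∷ F (D (iota A) x w) ∷ Γ) Δ → Transfers (F (D (iota A) x w) ∷ Γ) Δ
  case-LD₁ {w} {A} {x} ih σ {T} e with extL e
  ... | extl m e0 pT pD with persAvF pl-D m (inC pT)
  ...   | avE mD = applyLD₁ mD (ih σ (substEmbL (hd≡ _ (cong F (renInstσ σ w A x))) (consL mcon (embTr (subL-cons (_ ∷ [])) subR-refl e))))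
  ...   | avR (fmD (tiota r) rx) mD mE =
    applyLD₁ mD (ih σ (substEmbL (hd≡ _ (cong F (renInstσ σ w A x))) (consL (mrep (fmF (instFR rx r)) (there mE)) (embTr (subL-cons (_ ∷ [])) subR-refl e))))

  case-LD₂ : ∀ {w A x y Γ Δ} → Transfers (F (D (iota A) x w) ∷ Γ) ((w ∶ inst A y) ∷ Δ) → Transfers (F (w ∶ eqv x y) ∷ F (D (iota A) x w) ∷ Γ) Δ → Transfers (F (D (iota A) x w) ∷ Γ) Δ
  case-LD₂ {w} {A} {x} {y} ih1 ih2 σ {T} e with extL e
  ... | extl m e0 pT pD with persAvF pl-D m (inC pT)
  ...   | avE mD = applyLD₂ mD
            (ih1 σ (substEmbR (hd≡ _ (renInstσ σ w A y)) (consR rcon (embTr subL-refl (subR-cons (_ ∷ [])) e))))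
            (ih2 σ (consL mcon (embTr (subL-cons (_ ∷ [])) subR-refl e)))
  ...   | avR (fmD (tiota r) rx) mD mE = applyLD₂ mD
            (withSym mE λ X m' → ih1 σ (substEmbR (hd≡ _ (renInstσ σ w A y))
               (consR (rrep (fmF (flipF (instFR (vsame _) r))) m') (embGrowL X (embTr (subL-cons X) (subR-cons (_ ∷ [])) e)))))
            (ih2 σ (consL (mrep (fmF (feq rx (vsame _))) (there mE)) (embTr (subL-cons (_ ∷ [])) subR-refl e)))

  case-RD : ∀ {w A x z Γ Δ} → FreshVar z Γ (D (iota A) x w ∷ Δ) → Transfers Γ ((w ∶ inst A x) ∷ Δ) → Transfers (F (w ∶ inst A z) ∷ Γ) ((w ∶ eqv x z) ∷ Δ) → Transfers Γ (D (iota A) x w ∷ Δ)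
  case-RD {w} {A} {x} {z} {Γ} {Δ} nz ih1 ih2 σ {T} {TD} e with extR e
  ... | extr (rper () _) e0 pT pD
  ... | extr {TD0 = TD0} rcon e0 pT pD =
    exch ↭-refl (↭-sym pD) (RD (fresh∉ (varsSeq T (D (iota rA) (vs σ x) (ls σ w) ∷ TD0)))
      (ih1 σ (substEmbR (hd≡ _ (renInstσ σ w A x)) (embT (↭-sym pT) ↭-refl (consR rcon (embTr subL-refl (subR-con (λ ()) pD (_ ∷ [])) e0)))))
      (ih2 (updVar σ z z') (substEmb (premise-RD σ z' nz)
         (embT (↭-prep _ (↭-sym pT)) ↭-refl (consL mcon (consR rcon (embTr (subL-cons (_ ∷ [])) (subR-con (λ ()) pD (_ ∷ [])) e0)))))))
    where
    rA = renF (liftR (fren (vs σ))) A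
    z' = fresh (varsSeq T (D (iota rA) (vs σ x) (ls σ w) ∷ TD0))
  ... | extr {TD0 = TD0} (rrep {a} {b} {f' = D (iota A*) x* ._} (fmD (tiota r) rx) m) e0 pT pD =
    exch ↭-refl (↭-sym pD) (RD (fresh∉ (varsSeq T (D (iota A*) x* (ls σ w) ∷ TD0)))
      (ih1 σ (substEmbR (hd≡ _ (renInstσ σ w A x)) (embT (↭-sym pT) ↭-refl (consR (rrep (fmF (instFR rx r)) m) (embTr subL-refl (subR-con (λ ()) pD (_ ∷ [])) e0)))))
      (withSym (there m) λ X m' → ih2 (updVar σ z z') (substEmb (premise-RD σ z' nz)
         (embT (↭-trans (shifts (_ ∷ []) X) (++⁺ˡ X (↭-prep _ (↭-sym pT)))) ↭-refl
           (consL (mrep (fmF (flipF (instFR (vsame _) r))) m') (embGrowL X (consR (rrep (fmF (feq rx (vsame _))) (∈-++⁺ʳ X (there m)))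
             (embTr (λ p q → ∈-++⁺ʳ X (there q)) (subR-con (λ ()) pD (_ ∷ [])) e0))))))))
    where
    z' = fresh (varsSeq T (D (iota A*) x* (ls σ w) ∷ TD0))

  case-DenVar : ∀ {w x Γ Δ} → Transfers (F (D (var (fv x)) x w) ∷ Γ) Δ → Transfers Γ Δ
  case-DenVar ih σ e = DenVar (ih σ (consL mcon (embTr (subL-cons (_ ∷ [])) subR-refl e)))

  case-Ref= : ∀ {w x Γ Δ} → Transfers (F (w ∶ eqv x x) ∷ Γ) Δ → Transfers Γ Δ
  case-Ref= ih σ e = Ref= (ih σ (consL mcon (embTr (subL-cons (_ ∷ [])) subR-refl e)))

  -- Rules with an initial expression as principal premise: make it present first.
  case-DenId : ∀ {w x y Γ Δ} → Transfers (F (w ∶ eqv y x) ∷ F (D (var (fv y)) x w) ∷ Γ) Δ → Transfers (F (D (var (fv y)) x w) ∷ Γ) Δ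
  case-DenId ih σ {T} e with extL e
  ... | extl m e0 pT pD = exactL at-D (persAvF pl-D m (inC pT)) λ X mD →
          applyDenId mD (ih σ (consL mcon (embTr (subL-cons (_ ∷ [])) subR-refl (grow X e))))

  case-RigVar : ∀ {w v y z Γ Δ} → Transfers (F (v ∶ eqv y z) ∷ F (w ∶ eqv y z) ∷ Γ) Δ → Transfers (F (w ∶ eqv y z) ∷ Γ) Δ
  case-RigVar ih σ {T} e with extL e
  ... | extl m e0 pT pD = exactL (at-p (at-eq _ _)) (persAvF pl-eq m (inC pT)) λ X mE →
          rig mE (ih σ (consL mcon (embTr (subL-cons (_ ∷ [])) subR-refl (grow X e))))

  matDom : ∀ {T TD w a b u u'} → VarRep {0} a b (fv u) (fv u') → dom u w ∈ T → F (w ∶ eqv a b) ∈ T →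
           N ⊢ dom u' w ∷ T ⇒ TD → N ⊢ T ⇒ TD
  matDom {T} {TD} {w} {a} {b} {u} {u'} r m1 m2 d with two-split m1 m2
  ... | inj₂ ()
  ... | inj₁ (R , q) =
    exch (↭-sym q) ↭-refl (replStep {w = w} {E = dom (mkVar r x0) w} {x0 = x0} (r-dom _)
      (cong (λ p → dom p w) (subL-mkVar r x0 (λ e → nx (here e))))
      (cong (λ p → dom p w) (subR-mkVar r x0 (λ e → nx (there (here e)))))
      (exch (↭-prep _ q) ↭-refl d))
    where
    x0 = fresh (u ∷ u' ∷ [])
    nx = fresh∉ (u ∷ u' ∷ [])

  -- The Repl rule of the source: the replaced expression is already available
  -- in the target by a two-step replacement, which matL materialises.
  replF : ∀ {T TD f f' a b Γ' Δ'} → FmRep a b f f' → AtFm f → Emb T TD T TD (F f ∷ EqAt f a b ∷ Γ') Δ' →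
          (∀ {T'} → Emb T' TD T' TD (F f' ∷ F f ∷ EqAt f a b ∷ Γ') Δ' → N ⊢ T' ⇒ TD) → N ⊢ T ⇒ TD
  replF {T} r at e k with extL e
  ... | extl m1 e1 pT1 pD1 with extL e1
  ...   | extl m2 e2 pT2 pD2 =
    exactL at (persAvF (atPers at) m1 (inC pT1)) λ X1 mP →
    exactL (at-p (at-eq _ _)) (avLwk X1 (persAvF pl-eq m2 (λ q → inT0 pT1 (inC pT2 q)))) λ X2 mE →
    matThen (matL r at (∈-++⁺ʳ X2 mP) mE) λ X3 mQ →
    k (consL (mper (atPers (atR r at)) mQ) (grow X3 (grow X2 (grow X1 e))))

  replDom : ∀ {T TD w a b u u' Γ' Δ'} → VarRep {0} a b (fv u) (fv u') → Emb T TD T TD (dom u w ∷ F (w ∶ eqv a b) ∷ Γ') Δ' →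
          (∀ {T'} → Emb T' TD T' TD (dom u' w ∷ dom u w ∷ F (w ∶ eqv a b) ∷ Γ') Δ' → N ⊢ T' ⇒ TD) → N ⊢ T ⇒ TD
  replDom {T} r e k with extL e
  ... | extl m1 e1 pT1 pD1 with extL e1
  ...   | extl m2 e2 pT2 pD2 =
    exactL (at-p (at-eq _ _)) (persAvF pl-eq m2 (λ q → inT0 pT1 (inC pT2 q))) λ X mE →
    matDom r (∈-++⁺ʳ X (memDom m1 (inC pT1))) mE (k (consL mcon (embTr (subL-cons (_ ∷ [])) subR-refl (grow X e))))

  case-Repl : ∀ {w E x y z Γ Δ} → ReplItem w E → Transfers (subL z x E ∷ subL y x E ∷ F (w ∶ eqv y z) ∷ Γ) Δ → Transfers (subL y x E ∷ F (w ∶ eqv y z) ∷ Γ) Δ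
  case-Repl {x = x} {y} {z} (r-den v x1) ih σ e =
    replF (fmD (tvar (frenVR (vs σ) (subVR y z x (vsame v)))) (frenVR (vs σ) (subVR y z x (vsame (fv x1))))) (atD v) e (ih σ)
    where
    atD : ∀ (v : V 0) {x' w'} → AtFm (D (var (fren (vs σ) (fsubV y x v))) x' w')
    atD (fv _) = at-D
  case-Repl {x = x} {y} {z} (r-dom x1) ih σ e = replDom (frenVR (vs σ) (subVR y z x (vsame (fv x1)))) e (ih σ)
  case-Repl {x = x} {y} {z} (r-atom {p} at) ih σ e =
    replF (fmF (renFR (frenVR (vs σ)) (renFR (subVR y z x) (reflF p)))) (at-p (renAt (renAt at))) e (ih σ)
    where
    renAt : ∀ {p : Form 0} {ρ : V 0 → V 0} → IsAtomic p → IsAtomic (renF ρ p)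
    renAt (at-pred P xs) = at-pred P _
    renAt (at-eq x y) = at-eq _ _

  -- Non-logical rules: the relational and domain atoms occur literally in the
  -- target, so the same rule applies; Trans and Eucl degenerate to sharing when two
  -- matched atoms coincide.
  case-RefW : ∀ {w Γ Δ} → RefW ∈ N → Transfers (rel w w ∷ Γ) Δ → Transfers Γ Δ
  case-RefW p ih σ e = RefWR p (ih σ (consL mcon (embTr (subL-cons (_ ∷ [])) subR-refl e)))

  case-Cons : ∀ {x w Γ Δ} → Cons ∈ N → Transfers (dom x w ∷ Γ) Δ → Transfers Γ Δ
  case-Cons p ih σ e = ConsR p (ih σ (consL mcon (embTr (subL-cons (_ ∷ [])) subR-refl e)))

  case-Ser : ∀ {w u Γ Δ} → Ser ∈ N → FreshLab u Γ Δ → Transfers (rel w u ∷ Γ) Δ → Transfers Γ Δ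
  case-Ser {w} {u} {Γ} {Δ} p nu ih σ {T} {TD} e =
    SerR p (fresh∉ (labsSeq T TD)) (ih σ' (substEmbL eqΓ (substEmbR eqΔ (consL mcon (embTr (subL-cons (_ ∷ [])) subR-refl e)))))
    where
    u' = fresh (labsSeq T TD)
    σ' = updLab σ u u'
    eqΓ : map (renItem σ') (rel w u ∷ Γ) ≡ rel (ls σ' w) u' ∷ map (renItem σ) Γ
    eqΓ = cong₂ _∷_ (cong (rel _) (upd-here (ls σ) u u')) (updLLs σ u u' Γ (∉++ˡ nu))
    eqΔ : map (renFm σ') Δ ≡ map (renFm σ) Δ
    eqΔ = updLFms σ u u' Δ (∉++ʳ (concatMapL labsL Γ) nu)

  case-Trans : ∀ {w v u Γ Δ} → Trans ∈ N → Transfers (rel w u ∷ rel w v ∷ rel v u ∷ Γ) Δ → Transfers (rel w v ∷ rel v u ∷ Γ) Δ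
  case-Trans {w} {v} {u} p ih σ {T} {TD} e with extL e
  ... | extl m1 e1 pT1 pD1 with extL e1
  ...   | extl m2 e2 pT2 pD2 with two-split (memRel m1 (inC pT1)) (memRel m2 (λ q → inT0 pT1 (inC pT2 q)))
  ...     | inj₁ (R , q) = exch (↭-sym q) ↭-refl (TransR p (exch (↭-prep _ q) ↭-refl (ih σ (consL mcon (embTr (subL-cons (_ ∷ [])) subR-refl e)))))
  ...     | inj₂ eq = ih σ (consL (mper pl-rel (subst (λ q → rel (ls σ w) q ∈ T) (proj₂ (relInj eq)) (memRel m1 (inC pT1)))) e)

  case-Eucl : ∀ {w v u Γ Δ} → Eucl ∈ N → Transfers (rel v u ∷ rel w v ∷ rel w u ∷ Γ) Δ → Transfers (rel w v ∷ rel w u ∷ Γ) Δ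
  case-Eucl {w} {v} {u} p ih σ {T} {TD} e with extL e
  ... | extl m1 e1 pT1 pD1 with extL e1
  ...   | extl m2 e2 pT2 pD2 with two-split (memRel m1 (inC pT1)) (memRel m2 (λ q → inT0 pT1 (inC pT2 q)))
  ...     | inj₁ (R , q) = exch (↭-sym q) ↭-refl (EuclR p (exch (↭-prep _ q) ↭-refl (ih σ (consL mcon (embTr (subL-cons (_ ∷ [])) subR-refl e)))))
  ...     | inj₂ eq with ∈-split (memRel m1 (inC pT1))
  ...       | R , q = exch (↭-sym q) ↭-refl (EuclcR p (exch (↭-prep _ q) ↭-refl
                         (subst (λ z → N ⊢ rel (ls σ v) z ∷ T ⇒ TD) (sym (proj₂ (relInj eq)))
                           (ih σ (consL mcon (embTr (subL-cons (_ ∷ [])) subR-refl e))))))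

  case-Euclc : ∀ {w v Γ Δ} → Eucl ∈ N → Transfers (rel v v ∷ rel w v ∷ Γ) Δ → Transfers (rel w v ∷ Γ) Δ
  case-Euclc p ih σ {T} e with extL e
  ... | extl m1 e1 pT1 pD1 with ∈-split (memRel m1 (inC pT1))
  ...   | R , q = exch (↭-sym q) ↭-refl (EuclcR p (exch (↭-prep _ q) ↭-refl (ih σ (consL mcon (embTr (subL-cons (_ ∷ [])) subR-refl e)))))

  case-Incr : ∀ {x w v Γ Δ} → Incr ∈ N → Transfers (dom x v ∷ dom x w ∷ rel w v ∷ Γ) Δ → Transfers (dom x w ∷ rel w v ∷ Γ) Δ
  case-Incr p ih σ {T} e with extL e
  ... | extl m1 e1 pT1 pD1 with extL e1
  ...   | extl m2 e2 pT2 pD2 with two-split (memDom m1 (inC pT1)) (memRel m2 (λ q → inT0 pT1 (inC pT2 q)))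
  ...     | inj₁ (R , q) = exch (↭-sym q) ↭-refl (IncrR p (exch (↭-prep _ q) ↭-refl (ih σ (consL mcon (embTr (subL-cons (_ ∷ [])) subR-refl e)))))
  ...     | inj₂ ()

  case-Decr : ∀ {x w v Γ Δ} → Decr ∈ N → Transfers (dom x w ∷ dom x v ∷ rel w v ∷ Γ) Δ → Transfers (dom x v ∷ rel w v ∷ Γ) Δ
  case-Decr p ih σ {T} e with extL e
  ... | extl m1 e1 pT1 pD1 with extL e1
  ...   | extl m2 e2 pT2 pD2 with two-split (memDom m1 (inC pT1)) (memRel m2 (λ q → inT0 pT1 (inC pT2 q)))
  ...     | inj₁ (R , q) = exch (↭-sym q) ↭-refl (DecrR p (exch (↭-prep _ q) ↭-refl (ih σ (consL mcon (embTr (subL-cons (_ ∷ [])) subR-refl e)))))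
  ...     | inj₂ ()

  closeGen : ∀ {f Γ Δ} → AtFm f → ∀ {T TD} → Emb T TD T TD (F f ∷ Γ) (f ∷ Δ) → N ⊢ T ⇒ TD
  closeGen at e with extL e | extR e
  ... | extl m1 e1 pT1 pD1 | extr m2 e2 pT2 pD2 =
    closeAt at (persAvF (atPers at) m1 (inC pT1)) (persAvR (atPersR at) m2 (inC pD2))

  case-initAt : ∀ {w p Γ Δ} → IsAtomic p → Transfers (F (w ∶ p) ∷ Γ) ((w ∶ p) ∷ Δ)
  case-initAt (at-pred P xs) σ e = closeGen (at-p (at-pred P _)) e
  case-initAt (at-eq x y) σ e = closeGen (at-p (at-eq _ _)) e

  case-initD : ∀ {y x w Γ Δ} → Transfers (F (D (var (fv y)) x w) ∷ Γ) (D (var (fv y)) x w ∷ Δ)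
  case-initD σ e = closeGen at-D e

  case-initBot : ∀ {w Γ Δ} → Transfers (F (w ∶ Bot) ∷ Γ) Δ
  case-initBot σ e with extL e
  ... | extl m e0 pT pD with persAvF pl-bot m (inC pT)
  ...   | avE mB with ∈-split mB
  ...     | R , q = exch (↭-sym q) ↭-refl initBot
  case-initBot σ e | extl m e0 pT pD | avR (fmF fbot) mB _ with ∈-split mB
  ...     | R , q = exch (↭-sym q) ↭-refl initBot

  simulation : ∀ {Γ Δ} → N ⊢ Γ ⇒ Δ → Transfers Γ Δ
  simulation (exch p q d) σ e = simulation d σ (embPermR (↭-sym (map⁺ (renFm σ) q)) (embPermL (↭-sym (map⁺ (renItem σ) p)) e))
  simulation (initAt at) = case-initAt at
  simulation initD = case-initD
  simulation initBot = case-initBot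
  simulation (L∧ d) = case-L∧ (simulation d)
  simulation (R∧ d1 d2) = case-R∧ (simulation d1) (simulation d2)
  simulation (L∨ d1 d2) = case-L∨ (simulation d1) (simulation d2)
  simulation (R∨ d) = case-R∨ (simulation d)
  simulation (L⊃ d1 d2) = case-L⊃ (simulation d1) (simulation d2)
  simulation (R⊃ d) = case-R⊃ (simulation d)
  simulation (L∀ d) = case-L∀ (simulation d)
  simulation (R∀ nz d) = case-R∀ nz (simulation d)
  simulation (L∃ nz d) = case-L∃ nz (simulation d)
  simulation (R∃ d) = case-R∃ (simulation d)
  simulation (L□ d) = case-L□ (simulation d)
  simulation (R□ nu d) = case-R□ nu (simulation d)
  simulation (L◇ nu d) = case-L◇ nu (simulation d)
  simulation (R◇ d) = case-R◇ (simulation d)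
  simulation (Ref= d) = case-Ref= (simulation d)
  simulation (RigVar d) = case-RigVar (simulation d)
  simulation (Repl ri d) = case-Repl ri (simulation d)
  simulation (Lλ nz d) = case-Lλ nz (simulation d)
  simulation (Rλ d1 d2) = case-Rλ (simulation d1) (simulation d2)
  simulation (LD₁ d) = case-LD₁ (simulation d)
  simulation (LD₂ d1 d2) = case-LD₂ (simulation d1) (simulation d2)
  simulation (RD nz d1 d2) = case-RD nz (simulation d1) (simulation d2)
  simulation (DenVar d) = case-DenVar (simulation d)
  simulation (DenId d) = case-DenId (simulation d)
  simulation (RefWR p d) = case-RefW p (simulation d)
  simulation (SerR p nu d) = case-Ser p nu (simulation d)
  simulation (TransR p d) = case-Trans p (simulation d)
  simulation (EuclR p d) = case-Eucl p (simulation d)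
  simulation (EuclcR p d) = case-Euclc p (simulation d)
  simulation (IncrR p d) = case-Incr p (simulation d)
  simulation (DecrR p d) = case-Decr p (simulation d)
  simulation (ConsR p d) = case-Cons p (simulation d)

  transfer : ∀ {Γ Δ T TD} → N ⊢ Γ ⇒ Δ → Emb T TD T TD Γ Δ → N ⊢ T ⇒ TD
  transfer {Γ} {Δ} d e = simulation d idRen (substEmbL (mapRenItem-id Γ) (substEmbR (mapRenFm-id Δ) e))

  mutual
    initFormSized : ∀ n (A : Form 0) → sizeF A ≤ n → ∀ {w Γ Δ} → N ⊢ F (w ∶ A) ∷ Γ ⇒ (w ∶ A) ∷ Δ
    initFormSized n (Pr P xs) p = initAt (at-pred P xs)
    initFormSized n (Eq x y) p = initAt (at-eq x y)
    initFormSized n Bot p = initBot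
    initFormSized zero (And A B) ()
    initFormSized (suc n) (And A B) p {w} = L∧ (R∧ (initFormSized n A (≤ˡ p)) (exch swap2 ↭-refl (initFormSized n B (≤ʳ p))))
    initFormSized zero (Or A B) ()
    initFormSized (suc n) (Or A B) p = L∨ (R∨ (initFormSized n A (≤ˡ p))) (R∨ (exch ↭-refl swap2 (initFormSized n B (≤ʳ p))))
    initFormSized zero (Imp A B) ()
    initFormSized (suc n) (Imp A B) p = R⊃ (exch swap2 ↭-refl (L⊃ (initFormSized n A (≤ˡ p)) (initFormSized n B (≤ʳ p))))
    initFormSized zero (All A) ()
    initFormSized (suc n) (All A) (s≤s p) {w} {Γ} {Δ} =
      R∀ (fresh∉ (varsSeq (F (w ∶ All A) ∷ Γ) ((w ∶ All A) ∷ Δ)))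
        (L∀ (initFormSized n (inst A _) (≤-trans (≤-reflexive (sizeInst A _)) p)))
    initFormSized zero (Ex A) ()
    initFormSized (suc n) (Ex A) (s≤s p) {w} {Γ} {Δ} =
      L∃ (fresh∉ (varsSeq (F (w ∶ Ex A) ∷ Γ) ((w ∶ Ex A) ∷ Δ)))
        (R∃ (exch swap2 swap2 (initFormSized n (inst A _) (≤-trans (≤-reflexive (sizeInst A _)) p))))
    initFormSized zero (Box A) ()
    initFormSized (suc n) (Box A) (s≤s p) {w} {Γ} {Δ} =
      R□ (fresh∉ (labsSeq (F (w ∶ Box A) ∷ Γ) ((w ∶ Box A) ∷ Δ))) (L□ (initFormSized n A p))
    initFormSized zero (Dia A) ()
    initFormSized (suc n) (Dia A) (s≤s p) {w} {Γ} {Δ} =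
      L◇ (fresh∉ (labsSeq (F (w ∶ Dia A) ∷ Γ) ((w ∶ Dia A) ∷ Δ))) (R◇ (exch swap2 swap2 (initFormSized n A p)))
    initFormSized zero (Lam B t) ()
    initFormSized (suc n) (Lam B t) p {w} {Γ} {Δ} =
      Lλ (fresh∉ (varsSeq (F (w ∶ Lam B t) ∷ Γ) ((w ∶ Lam B t) ∷ Δ)))
        (Rλ (exch ↭-refl swap2 (initDenSized n t (≤ʳ p)))
            (exch swap2 swap2 (initFormSized n (inst B _) (≤-trans (≤-reflexive (sizeInst B _)) (≤ˡ p)))))

    initDenSized : ∀ n (t : Term 0) → sizeT t ≤ n → ∀ {x w Γ Δ} → N ⊢ F (D t x w) ∷ Γ ⇒ D t x w ∷ Δ
    initDenSized n (var (fv y)) p = initD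
    initDenSized zero (iota A) ()
    initDenSized (suc n) (iota A) (s≤s p) {x} {w} {Γ} {Δ} =
      RD (fresh∉ (varsSeq (F (D (iota A) x w) ∷ Γ) (D (iota A) x w ∷ Δ)))
        (LD₁ (initFormSized n (inst A x) (≤-trans (≤-reflexive (sizeInst A x)) p)))
        (exch swap2 ↭-refl (LD₂ (exch swap2 ↭-refl (initFormSized n (inst A _) (≤-trans (≤-reflexive (sizeInst A _)) p)))
                              (initAt (at-eq _ _))))

  initForm : ∀ w A {Γ Δ} → N ⊢ F (w ∶ A) ∷ Γ ⇒ (w ∶ A) ∷ Δ
  initForm w A = initFormSized (sizeF A) A ≤-refl

  initDen : ∀ t x w {Γ Δ} → N ⊢ F (D t x w) ∷ Γ ⇒ D t x w ∷ Δ
  initDen t x w = initDenSized (sizeT t) t ≤-refl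

  -- Contraction of a persistent expression: share the second copy.
  contrPL : ∀ {x Γ Δ} → PersL x → N ⊢ x ∷ x ∷ Γ ⇒ Δ → N ⊢ x ∷ Γ ⇒ Δ
  contrPL {Γ = Γ} {Δ} p d = transfer d (consL mcon (consL (mper p (here refl)) (idE Γ Δ)))

  contrPR : ∀ {y Γ Δ} → PersR y → N ⊢ Γ ⇒ y ∷ y ∷ Δ → N ⊢ Γ ⇒ y ∷ Δ
  contrPR {Γ = Γ} {Δ} p d = transfer d (consR rcon (consR (rper p (here refl)) (idE Γ Δ)))

  -- Admissibility of contraction of labelled formulas, on both sides, by
  -- induction on the size: non-persistent formulas are inverted on both copies
  -- (by the simulation lemma), contracted on the components, and rebuilt.
  mutual
    contractLSized : ∀ n (A : Form 0) → sizeF A ≤ n → ∀ {w Γ Δ} → N ⊢ F (w ∶ A) ∷ F (w ∶ A) ∷ Γ ⇒ Δ → N ⊢ F (w ∶ A) ∷ Γ ⇒ Δ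
    contractLSized n (Pr P xs) p d = contrPL pl-pr d
    contractLSized n (Eq x y) p d = contrPL pl-eq d
    contractLSized n Bot p d = contrPL pl-bot d
    contractLSized n (All A) p d = contrPL pl-all d
    contractLSized n (Box A) p d = contrPL pl-box d
    contractLSized zero (And A B) ()
    contractLSized (suc n) (And A B) p {w} {Γ} {Δ} d =
      L∧ (exch swap2 ↭-refl (contractLSized n B (≤ʳ p) (exch rot3 ↭-refl (contractLSized n A (≤ˡ p)
        (exch (↭-prep _ swap2) ↭-refl (transfer d (consL mand (consL mand (idE Γ Δ)))))))))
    contractLSized zero (Or A B) ()
    contractLSized (suc n) (Or A B) p {w} {Γ} {Δ} d =
      L∨ (contractLSized n A (≤ˡ p) (transfer d (consL mor1 (consL mor1 (idE Γ Δ)))))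
         (contractLSized n B (≤ʳ p) (transfer d (consL mor2 (consL mor2 (idE Γ Δ)))))
    contractLSized zero (Imp A B) ()
    contractLSized (suc n) (Imp A B) p {w} {Γ} {Δ} d =
      L⊃ (contractRSized n A (≤ˡ p) (transfer d (consL mimp1 (consL mimp1 (idE Γ Δ)))))
         (contractLSized n B (≤ʳ p) (transfer d (consL mimp2 (consL mimp2 (idE Γ Δ)))))
    contractLSized zero (Ex A) ()
    contractLSized (suc n) (Ex A) (s≤s p) {w} {Γ} {Δ} d =
      L∃ (fresh∉ (varsSeq (F (w ∶ Ex A) ∷ Γ) Δ))
        (exch swap2 ↭-refl (contractLSized n (inst A _) (sizeI A _ p)
          (exch rot3 ↭-refl (transfer d (embGrowL (dom _ w ∷ []) (consL (mex (here refl)) (consL (mex (here refl)) (idE Γ Δ))))))))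
    contractLSized zero (Dia A) ()
    contractLSized (suc n) (Dia A) (s≤s p) {w} {Γ} {Δ} d =
      L◇ (fresh∉ (labsSeq (F (w ∶ Dia A) ∷ Γ) Δ))
        (exch swap2 ↭-refl (contractLSized n A p
          (exch rot3 ↭-refl (transfer d (embGrowL (rel w _ ∷ []) (consL (mdia (here refl)) (consL (mdia (here refl)) (idE Γ Δ))))))))
    contractLSized zero (Lam B t) ()
    contractLSized (suc n) (Lam B t) p {w} {Γ} {Δ} d =
      Lλ (fresh∉ (varsSeq (F (w ∶ Lam B t) ∷ Γ) Δ))
        (exch swap2 ↭-refl (contractLSized n (inst B _) (sizeI B _ (≤ˡ p))
          (exch rot3 ↭-refl (transfer d (embGrowL (F (D t _ w) ∷ []) (consL (mlam (here refl)) (consL (mlam (here refl)) (idE Γ Δ))))))))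

    contractRSized : ∀ n (A : Form 0) → sizeF A ≤ n → ∀ {w Γ Δ} → N ⊢ Γ ⇒ (w ∶ A) ∷ (w ∶ A) ∷ Δ → N ⊢ Γ ⇒ (w ∶ A) ∷ Δ
    contractRSized n (Pr P xs) p d = contrPR pr-pr d
    contractRSized n (Eq x y) p d = contrPR pr-eq d
    contractRSized n Bot p d = contrPR pr-bot d
    contractRSized n (Ex A) p d = contrPR pr-ex d
    contractRSized n (Dia A) p d = contrPR pr-dia d
    contractRSized n (Lam A t) p d = contrPR pr-lam d
    contractRSized zero (And A B) ()
    contractRSized (suc n) (And A B) p {w} {Γ} {Δ} d =
      R∧ (contractRSized n A (≤ˡ p) (transfer d (consR rand1 (consR rand1 (idE Γ Δ)))))
         (contractRSized n B (≤ʳ p) (transfer d (consR rand2 (consR rand2 (idE Γ Δ)))))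
    contractRSized zero (Or A B) ()
    contractRSized (suc n) (Or A B) p {w} {Γ} {Δ} d =
      R∨ (exch ↭-refl swap2 (contractRSized n B (≤ʳ p) (exch ↭-refl rot3 (contractRSized n A (≤ˡ p)
        (exch ↭-refl (↭-prep _ swap2) (transfer d (consR ror (consR ror (idE Γ Δ)))))))))
    contractRSized zero (Imp A B) ()
    contractRSized (suc n) (Imp A B) p {w} {Γ} {Δ} d =
      R⊃ (contractLSized n A (≤ˡ p) (contractRSized n B (≤ʳ p) (transfer d (consR rimp (consR rimp (idE Γ Δ))))))
    contractRSized zero (All A) ()
    contractRSized (suc n) (All A) (s≤s p) {w} {Γ} {Δ} d =
      R∀ (fresh∉ (varsSeq Γ ((w ∶ All A) ∷ Δ)))
        (contractRSized n (inst A _) (sizeI A _ p) (transfer d (embGrowL (dom _ w ∷ []) (consR (rall (here refl)) (consR (rall (here refl)) (idE Γ Δ))))))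
    contractRSized zero (Box A) ()
    contractRSized (suc n) (Box A) (s≤s p) {w} {Γ} {Δ} d =
      R□ (fresh∉ (labsSeq Γ ((w ∶ Box A) ∷ Δ)))
        (contractRSized n A p (transfer d (embGrowL (rel w _ ∷ []) (consR (rbox (here refl)) (consR (rbox (here refl)) (idE Γ Δ))))))

  contractL : ∀ {w A Γ Δ} → N ⊢ F (w ∶ A) ∷ F (w ∶ A) ∷ Γ ⇒ Δ → N ⊢ F (w ∶ A) ∷ Γ ⇒ Δ
  contractL {A = A} = contractLSized (sizeF A) A ≤-refl

  initExpr : ∀ f {Γ Δ} → N ⊢ F f ∷ Γ ⇒ f ∷ Δ
  initExpr (w ∶ A) = initForm w A
  initExpr (D t x w) = initDen t x w

  contractExpr : ∀ f {Γ Δ} → N ⊢ F f ∷ F f ∷ Γ ⇒ Δ → N ⊢ F f ∷ Γ ⇒ Δ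
  contractExpr (w ∶ A) = contractL
  contractExpr (D t x w) = contrPL pl-D

  -- Replacement: if f' arises from f by replacing a by b, then a = b, f ⇒ f'.
  -- The generalised initial sequent f ⇒ f transfers along a right replacement.
  replacement : ∀ {a b f f'} → FmRep a b f f' → N ⊢ EqAt f a b ∷ F f ∷ [] ⇒ f' ∷ []
  replacement {a} {b} {f} r =
    transfer (initExpr f {[]} {[]}) (embGrowL (EqAt f a b ∷ []) (consL mcon (consR (rrep r (here refl)) nilE)))

  -- Admissibility of replacement on the left: the premise transfers to the
  -- conclusion with an extra copy of f, from which f' is obtained by a left
  -- replacement; that copy is then contracted.
  admissibleRepl : ∀ {a b f f' Γ Δ} → FmRep a b f f' →
                   N ⊢ F f' ∷ EqAt f a b ∷ F f ∷ Γ ⇒ Δ → N ⊢ EqAt f a b ∷ F f ∷ Γ ⇒ Δ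
  admissibleRepl {a} {b} {f} {f'} {Γ} {Δ} r d =
    exch swap2 ↭-refl (contractExpr f
      (transfer d (embT (↭-prep _ swap2) ↭-refl
        (consL (mrep r eqInTarget) (consL mcon (consL mcon (idE Γ Δ)))))))
    where
    eqInTarget : EqAt f' a b ∈ F f ∷ F f ∷ EqAt f a b ∷ Γ
    eqInTarget = subst (λ l → F (l ∶ eqv a b) ∈ F f ∷ F f ∷ EqAt f a b ∷ Γ) (labEq r) (there (there (here refl)))

  reflexivity : ∀ w x → N ⊢ [] ⇒ (w ∶ eqv x x) ∷ []
  reflexivity w x = Ref= (initAt (at-eq _ _))

  -- Symmetry: replace the first x in x = x by y, using x = y.
  symmetry : ∀ w x y → N ⊢ F (w ∶ eqv x y) ∷ [] ⇒ (w ∶ eqv y x) ∷ []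
  symmetry w x y = Ref= (exch swap2 ↭-refl (replacement (fmF (feq vab (vsame (fv x))))))

  -- Transitivity: replace y in x = y by z, using y = z.
  transitivity : ∀ w x y z → N ⊢ F (w ∶ eqv x y) ∷ F (w ∶ eqv y z) ∷ [] ⇒ (w ∶ eqv x z) ∷ []
  transitivity w x y z = exch swap2 ↭-refl (replacement (fmF (feq (vsame (fv x)) vab)))

substRepF : ∀ w z y x A → FmRep z y (w ∶ subF z x A) (w ∶ subF y x A)
substRepF w z y x A = fmF (renFR (subVR z y x) (reflF A))

substRepD : ∀ w z y x t x₁ → FmRep z y (subFm z x (D t x₁ w)) (subFm y x (D t x₁ w))
substRepD w z y x t x₁ = fmD (renTR (subVR z y x) (reflT t)) (subVR z y x (vsame (fv x₁)))

mainTheorem10 : (N : List NRule) →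
    -- (1) identity is an equivalence relation
    ((w : Label) (x y z : Var) →
        (N ⊢ [] ⇒ (w ∶ eqv x x) ∷ [])
      × (N ⊢ F (w ∶ eqv x y) ∷ [] ⇒ (w ∶ eqv y x) ∷ [])
      × (N ⊢ F (w ∶ eqv x y) ∷ F (w ∶ eqv y z) ∷ [] ⇒ (w ∶ eqv x z) ∷ []))
    -- (2a)
  × ((w : Label) (x : Var) → N ⊢ [] ⇒ (w ∶ eqv x x) ∷ [])
    -- (2b)
  × ((w : Label) (x y z : Var) (A : Form 0) →
        N ⊢ F (w ∶ eqv z y) ∷ F (w ∶ subF z x A) ∷ [] ⇒ (w ∶ subF y x A) ∷ [])
    -- (2c)
  × ((w : Label) (x y z x₁ : Var) (t : Term 0) →
        N ⊢ F (w ∶ eqv z y) ∷ F (subFm z x (D t x₁ w)) ∷ [] ⇒ subFm y x (D t x₁ w) ∷ [])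
    -- (3) Repl₁
  × ((w : Label) (x y z : Var) (A : Form 0) (Γ : List LItem) (Δ : List Fm) →
        N ⊢ F (w ∶ subF y x A) ∷ F (w ∶ eqv z y) ∷ F (w ∶ subF z x A) ∷ Γ ⇒ Δ →
        N ⊢ F (w ∶ eqv z y) ∷ F (w ∶ subF z x A) ∷ Γ ⇒ Δ)
    -- (3) Repl₂
  × ((w : Label) (x y z x₁ : Var) (t : Term 0) (Γ : List LItem) (Δ : List Fm) →
        N ⊢ F (subFm y x (D t x₁ w)) ∷ F (w ∶ eqv z y) ∷ F (subFm z x (D t x₁ w)) ∷ Γ ⇒ Δ →
        N ⊢ F (w ∶ eqv z y) ∷ F (subFm z x (D t x₁ w)) ∷ Γ ⇒ Δ)
mainTheorem10 N =
    (λ w x y z → reflexivity N w x , symmetry N w x y , transitivity N w x y z)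
  , reflexivity N
  , (λ w x y z A → replacement N (substRepF w z y x A))
  , (λ w x y z x₁ t → replacement N (substRepD w z y x t x₁))
  , (λ w x y z A Γ Δ → admissibleRepl N (substRepF w z y x A))
  , (λ w x y z x₁ t Γ Δ → admissibleRepl N (substRepD w z y x t x₁))
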